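{- As $\mathbf c$ ranges over the $t!$ linear orders on $c_1,\dots,c_t$, the isomorphism classes (under label-preserving isomorphism) of the labelled graphs $\mathscr G(\mathbf c)$ are parametrized by the nondecreasing integer sequences $1\le r_1\le r_2\le\dots\le r_t\le t$ with $r_i\le i$ for all $i$: the class of $\mathscr G(\mathbf c)$ corresponds to the unique nondecreasing sequence obtained from the canonical sequence of $\mathbf c$ by finitely many switches, where a switch replaces two consecutive entries $r_i>r_{i+1}$ by $r_{i+1},r_i+1$. In particular the number of isomorphism classes is the Catalan number $\mathcal C_t=\frac{(2t)!}{t!(t+1)!}$.
   Context: Let $T=\{1,\dots,t\}$. A linear order $\mathbf c$ on symbols $c_1,\dots,c_t$ determines a labelled graph $\mathscr G(\mathbf c)$ (vertices labelled in $\{1,\dots,t+1\}$, edges labelled in $T$), defined inductively. For $t=1$: two vertices labelled $1$ and $2$ joined by an edge labelled $1$. For $t\ge2$: let $c_s$ be the maximal element of $\mathbf c$. Let $\mathbf c'$ be the induced order on $\mathbf c\setminus\{c_s\}$, reindexed by keeping indices $<s$ and decreasing indices $>s$ by $1$; let $\mathscr G'=\mathscr G(\mathbf c')$. Let $\mathscr G^+$ be a copy of $\mathscr G'$ in which every label (on vertices and edges) $\ell\le s-1$ is kept and every label $\ell\ge s$ is replaced by $\ell+1$. Let $\mathscr G^-$ be a second copy of the same underlying graph, with $\varphi:\mathscr G^+\to\mathscr G^-$ the identification, carrying the same labels except that vertices labelled $s+1$ in $\mathscr G^+$ are labelled $s$ in $\mathscr G^-$. Then $\mathscr G(\mathbf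 c)$ is the disjoint union of $\mathscr G^+$ and $\mathscr G^-$ together with, for each vertex $v$ of $\mathscr G^+$ of label $s+1$, an edge labelled $s$ joining $v$ and $\varphi(v)$. Canonical sequence of $\mathbf c$: let $(k_1,\dots,k_t)$ be the permutation of $T$ with $c_{k_1}<\dots<c_{k_t}$, and set $n(k_i)=k_i-|\{j>i: k_j<k_i\}|$; the canonical sequence is $(n(k_1),\dots,n(k_t))$ (it satisfies $1\le n(k_i)\le i$). -}

module Defs where

open import Data.Nat using (ℕ; zero; suc; _+_; _∸_; _<_; _≤_; _<ᵇ_; _≡ᵇ_; _<?_)
open import Data.Bool using (Bool; true; false; if_then_else_)
open import Data.Fin using (Fin; toℕ; _↑ˡ_; _↑ʳ_; splitAt)
open import Data.Sum using (_⊎_; [_,_]′)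
open import Data.Product using (Σ; _×_; _,_; proj₁)
open import Data.List using (List; []; _∷_; _++_; map; upTo; length; filter; concat; allFin; lookup; [_])
open import Data.List.Membership.Propositional using (_∈_)
open import Data.List.Relation.Binary.Permutation.Propositional using (_↭_)
open import Data.List.Relation.Unary.Linked using (Linked)
open import Relation.Binary.Construct.Closure.ReflexiveTransitive using (Star)
open import Relation.Binary.PropositionalEquality using (_≡_)
open import Function.Bundles using (_↔_; _⇔_; Inverse)

-- Linear orders on c_1,…,c_t.
-- An order is encoded by the list [k_1,…,k_t] (a permutation of 1,…,t)
-- with c_{k_1} < c_{k_2} < … < c_{k_t}.

T : ℕ → List ℕ
T t = map suc (upTo t)

Order : ℕ → Set
Order t = Σ (List ℕ) (λ ks → ks ↭ T t)

-- Labelled graphs: V vertices (Fin V), vertex labels, and a list of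
-- undirected labelled edges (u , v , ℓ).

record LGraph : Set where
  field
    V     : ℕ
    lab   : Fin V → ℕ
    edges : List (Fin V × Fin V × ℕ)
open LGraph public

Adj : (G : LGraph) → Fin (V G) → Fin (V G) → ℕ → Set
Adj G u v ℓ = ((u , v , ℓ) ∈ edges G) ⊎ ((v , u , ℓ) ∈ edges G)

Iso : LGraph → LGraph → Set
Iso G H = Σ (Fin (V G) ↔ Fin (V H)) λ f →
  let φ = Inverse.to f in
  (∀ v → lab H (φ v) ≡ lab G v) ×
  (∀ u v ℓ → Adj G u v ℓ ⇔ Adj H (φ u) (φ v) ℓ)

-- all but the last element / the last element (default 0 on [])
dropLast : List ℕ → List ℕ
dropLast []           = []
dropLast (x ∷ [])     = []
dropLast (x ∷ y ∷ xs) = x ∷ dropLast (y ∷ xs)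

lastOr0 : List ℕ → ℕ
lastOr0 []           = 0
lastOr0 (x ∷ [])     = x
lastOr0 (x ∷ y ∷ xs) = lastOr0 (y ∷ xs)

reindex : ℕ → ℕ → ℕ
reindex s k = if k <ᵇ s then k else k ∸ 1

-- label change for 𝒢⁺ : ℓ ≤ s-1 kept, ℓ ≥ s becomes ℓ+1
relabel : ℕ → ℕ → ℕ
relabel s ℓ = if ℓ <ᵇ s then ℓ else suc ℓ

-- the induced order c' (as a list k'_1,…,k'_{t-1})
restrict : List ℕ → List ℕ
restrict ks = map (reindex (lastOr0 ks)) (dropLast ks)

-- one doubling step: from 𝒢' = 𝒢(c') build 𝒢(c), s the index of the max
double : ℕ → LGraph → LGraph
double s G' = record { V = n + n ; lab = labG ; edges = E }
  where
  n = V G'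
  lab⁺ : Fin n → ℕ
  lab⁺ v = relabel s (lab G' v)
  lab⁻ : Fin n → ℕ
  lab⁻ v = if lab⁺ v ≡ᵇ suc s then s else lab⁺ v
  labG : Fin (n + n) → ℕ
  labG i = [ lab⁺ , lab⁻ ]′ (splitAt n i)
  E⁺ : List (Fin (n + n) × Fin (n + n) × ℕ)
  E⁺ = map (λ { (u , w , ℓ) → (u ↑ˡ n , w ↑ˡ n , relabel s ℓ) }) (edges G')
  E⁻ : List (Fin (n + n) × Fin (n + n) × ℕ)
  E⁻ = map (λ { (u , w , ℓ) → (n ↑ʳ u , n ↑ʳ w , relabel s ℓ) }) (edges G')
  Em : List (Fin (n + n) × Fin (n + n) × ℕ)
  Em = concat (map (λ v → if lab⁺ v ≡ᵇ suc s then [ (v ↑ˡ n , n ↑ʳ v , s) ] else []) (allFin n))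
  E : List (Fin (n + n) × Fin (n + n) × ℕ)
  E = E⁺ ++ E⁻ ++ Em

base : LGraph
base = record { V = 2 ; lab = l ; edges = [ (Fin.zero , Fin.suc Fin.zero , 1) ] }
  where
  l : Fin 2 → ℕ
  l Fin.zero = 1
  l (Fin.suc _) = 2

-- 𝒢 for an order on t symbols given as its list [k_1,…,k_t]  (t = 0 is unused)
graphL : ℕ → List ℕ → LGraph
graphL zero          ks = base
graphL (suc zero)    ks = base
graphL (suc (suc t)) ks = double (lastOr0 ks) (graphL (suc t) (restrict ks))

𝒢 : ∀ t → Order t → LGraph
𝒢 t c = graphL t (proj₁ c)

canon : List ℕ → List ℕ
canon []       = []
canon (k ∷ ks) = (k ∸ length (filter (_<? k) ks)) ∷ canon ks

data Switch : List ℕ → List ℕ → Set where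
  sw : ∀ xs a b ys → b < a → Switch (xs ++ a ∷ b ∷ ys) (xs ++ b ∷ suc a ∷ ys)

Nondecreasing : List ℕ → Set
Nondecreasing = Linked _≤_

NormalOf : List ℕ → List ℕ → Set
NormalOf x r = Star Switch x r × Nondecreasing r

Admissible : ℕ → List ℕ → Set
Admissible t r = (length r ≡ t) × Nondecreasing r ×
  (∀ (i : Fin (length r)) → 1 ≤ lookup r i × lookup r i ≤ suc (toℕ i))

module Submission where

-- The proof goes through the graph of a sequence: seqGraph (r₁,…,r_t) is
-- obtained from one vertex by doubling successively at r₁, …, r_t.
--   * Switches: inserting entries from the right gives a normal form which
--     is reachable by switches and invariant under them, so every sequence
--     has a unique nondecreasing form under switches.
--   * Doubling at a and then at b < a gives, up to isomorphism, the same
--     graph as doubling at b and then at a+1; hence switches preserve the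
--     isomorphism class of seqGraph.
--   * 𝒢(c) ≅ seqGraph (canonical sequence of c), by induction removing the
--     maximal symbol; canonical sequences are bounded and every admissible
--     sequence is canonical for an explicit order.
--   * For admissible r the numbers of vertices of each label in seqGraph r
--     determine r, so non-equal normal forms give non-isomorphic graphs.
--   * Admissible sequences are listed explicitly and counted by ballot
--     numbers, giving the Catalan number (2t)! / (t! (t+1)!).

open import Defs
open import Data.Nat using (ℕ; zero; suc; _+_; _*_; _∸_; _<_; _≤_; _!; _≡ᵇ_; _<?_; _≟_; z≤n; s≤s)
open import Data.Nat.Properties
  using (≤-trans; <-trans; ≤-refl; <⇒≤; ≮⇒≥; n<1+n; n≤1+n; m≤n⇒m≤1+n; <-irrefl; <-≤-trans; ≤-<-trans; ≤⇒≯;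
         suc-injective; <-cmp; <ᵇ-reflects-<; ≡ᵇ⇒≡; ≡⇒≡ᵇ; +-assoc; +-identityʳ; +-suc; +-comm; +-mono-<; ≤-pred;
         m≤m+n; ∸-+-assoc; ∸-monoˡ-≤; ∸-monoˡ-<; m∸n≤m; ∸-monoʳ-≤; ∸-cancelˡ-≡; m∸[m∸n]≡n; ≤∧≢⇒<;
         m≤n⇒m<n∨m≡n; *-identityˡ; +-0-commutativeMonoid)
open import Data.Nat.Tactic.RingSolver using (solve-∀)
open import Data.Bool using (Bool; true; false; if_then_else_)
open import Data.Fin using (Fin; toℕ; _↑ˡ_; _↑ʳ_; splitAt) renaming (zero to fzero; suc to fsuc)
open import Data.Fin.Properties using (splitAt-↑ˡ; splitAt-↑ʳ; splitAt⁻¹-↑ˡ; splitAt⁻¹-↑ʳ)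
open import Data.Sum using (_⊎_; inj₁; inj₂; [_,_]′)
open import Data.Product using (Σ; ∃-syntax; _×_; _,_; proj₁; proj₂)
open import Data.Unit using (⊤; tt)
open import Data.Empty using (⊥-elim)
open import Data.Vec.Functional using (Vector; tail) renaming (_++_ to _++ᵛ_)
open import Data.List using (List; []; _∷_; _++_; _∷ʳ_; length; lookup; [_]; map; filter; foldl; allFin; reverse; upTo)
open import Data.List.Properties
  using (foldl-++; length-++; filter-accept; filter-reject; filter-++; length-map; ∷-injective; map-++; map-∘;
         map-cong; map-id; map-id-local; reverse-++; upTo-∷ʳ; length-upTo; ++-assoc)
open import Data.List.Reverse using (Reverse; []; _∶_∶ʳ_; reverseView)
open import Data.List.Membership.Propositional using (_∈_; mapWith∈)
open import Data.List.Membership.Propositional.Properties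
  using (∈-map⁺; ∈-map⁻; ∈-++⁺ˡ; ∈-++⁺ʳ; ∈-++⁻; ∈-concat⁺′; ∈-concat⁻′; ∈-allFin)
open import Data.List.Membership.Setoid.Properties using (length-mapWith∈)
open import Data.List.Relation.Unary.Any using (Any; here; there)
open import Data.List.Relation.Unary.Any.Properties using (mapWith∈⁺)
open import Data.List.Relation.Unary.All using (All; []; _∷_)
import Data.List.Relation.Unary.All as All
import Data.List.Relation.Unary.All.Properties as All
open import Data.List.Relation.Unary.AllPairs using (AllPairs; []; _∷_)
open import Data.List.Relation.Unary.Linked using ([]; [-]; _∷_)
import Data.List.Relation.Unary.Linked as Linked
open import Data.List.Relation.Unary.Unique.Propositional using (Unique)
import Data.List.Relation.Unary.Unique.Propositional.Properties as Unique
open import Data.List.Relation.Binary.Permutation.Propositional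
  using (_↭_; ↭-refl; ↭-reflexive; ↭-swap; ↭-sym; ↭⇒↭ₛ; module PermutationReasoning)
open import Data.List.Relation.Binary.Permutation.Propositional.Properties using (++⁺ˡ; ++⁺ʳ; All-resp-↭; ↭-length)
import Data.List.Relation.Binary.Permutation.Propositional.Properties as Perm
open import Relation.Binary using (Tri; tri<; tri≈; tri>)
open import Relation.Binary.Construct.Closure.ReflexiveTransitive using (Star; ε; _◅_; _◅◅_; gmap)
open import Relation.Binary.PropositionalEquality
  using (_≡_; _≢_; _≗_; refl; sym; trans; cong; cong₂; subst; subst₂; setoid; module ≡-Reasoning)
open import Data.List.Relation.Binary.Permutation.Setoid.Properties (setoid ℕ) using (Unique-resp-↭)
open import Algebra.Properties.CommutativeMonoid.Sum +-0-commutativeMonoid using (sum; sum-cong-≗; sum-replicate-zero; ∑-permute)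
open import Relation.Nullary using (Dec; yes; no; ¬_)
open import Relation.Nullary.Reflects using (Reflects; ofʸ; ofⁿ; fromEquivalence)
open import Function.Bundles using (_⇔_; mk⇔; Inverse; mk↔ₛ′; module Equivalence)

-- Inserting a into a nondecreasing list by switches: while the next entry
-- b satisfies b < a, the switch (a , b) ↦ (b , a + 1) moves a to the right.
insert : ℕ → List ℕ → List ℕ
insert a []       = a ∷ []
insert a (b ∷ ys) with b <? a
... | yes _ = b ∷ insert (suc a) ys
... | no  _ = a ∷ b ∷ ys

normalForm : List ℕ → List ℕ
normalForm []       = []
normalForm (a ∷ rs) = insert a (normalForm rs)

Switches : List ℕ → List ℕ → Set
Switches = Star Switch

switch-cons : ∀ {x y} c → Switch x y → Switch (c ∷ x) (c ∷ y)
switch-cons c (sw xs a b ys b<a) = sw (c ∷ xs) a b ys b<a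

switches-cons : ∀ {x y} c → Switches x y → Switches (c ∷ x) (c ∷ y)
switches-cons c = gmap (c ∷_) (switch-cons c)

insert-switches : ∀ a zs → Switches (a ∷ zs) (insert a zs)
insert-switches a []       = ε
insert-switches a (b ∷ ys) with b <? a
... | yes b<a = sw [] a b ys b<a ◅ switches-cons b (insert-switches (suc a) ys)
... | no  _   = ε

normalForm-switches : ∀ x → Switches x (normalForm x)
normalForm-switches []       = ε
normalForm-switches (a ∷ rs) =
  switches-cons a (normalForm-switches rs) ◅◅ insert-switches a (normalForm rs)

insert-sorted : ∀ {b} a zs → b ≤ a → Nondecreasing (b ∷ zs) → Nondecreasing (b ∷ insert a zs)
insert-sorted a []       b≤a _ = b≤a ∷ [-]
insert-sorted a (c ∷ ys) b≤a (b≤c ∷ sorted) with c <? a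
... | yes c<a = b≤c ∷ insert-sorted (suc a) ys (m≤n⇒m≤1+n (<⇒≤ c<a)) sorted
... | no  c≮a = b≤a ∷ ≮⇒≥ c≮a ∷ sorted

-- Hence the normal form is nondecreasing (start below 0, then drop the bound).
normalForm-sorted : ∀ x → Nondecreasing (normalForm x)
normalForm-sorted x = Linked.tail (bounded x)
  where
  bounded : ∀ x → Nondecreasing (0 ∷ normalForm x)
  bounded []       = [-]
  bounded (a ∷ rs) = insert-sorted a (normalForm rs) z≤n (bounded rs)

insert-head : ∀ a zs → Nondecreasing (a ∷ zs) → insert a zs ≡ a ∷ zs
insert-head a []       _         = refl
insert-head a (b ∷ ys) (a≤b ∷ _) with b <? a
... | yes b<a = ⊥-elim (<-irrefl refl (<-≤-trans b<a a≤b))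
... | no  _   = refl

normalForm-sorted-id : ∀ r → Nondecreasing r → normalForm r ≡ r
normalForm-sorted-id []       _      = refl
normalForm-sorted-id (a ∷ rs) sorted
  rewrite normalForm-sorted-id rs (Linked.tail sorted) = insert-head a rs sorted

insert-pass : ∀ {a b} ys → b < a → insert a (b ∷ ys) ≡ b ∷ insert (suc a) ys
insert-pass {a} {b} ys b<a with b <? a
... | yes _   = refl
... | no  b≮a = ⊥-elim (b≮a b<a)

insert-stop : ∀ {a b} ys → ¬ b < a → insert a (b ∷ ys) ≡ a ∷ b ∷ ys
insert-stop {a} {b} ys b≮a with b <? a
... | yes b<a = ⊥-elim (b≮a b<a)
... | no  _   = refl

-- The key commutation: inserting a then b agrees with inserting b then a+1,
-- which is exactly the effect of a switch on the normal form.
insert-comm : ∀ a b zs → b < a → Nondecreasing zs → insert a (insert b zs) ≡ insert b (insert (suc a) zs)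
insert-comm a b [] b<a _ =
  trans (insert-pass [] b<a) (sym (insert-stop [] λ a+1<b → <-irrefl refl (<-trans b<a (<-trans (n<1+n a) a+1<b))))
insert-comm a b (c ∷ zs) b<a sorted = byCase (c <? b)
  where
  open ≡-Reasoning
  byCase : Dec (c < b) → insert a (insert b (c ∷ zs)) ≡ insert b (insert (suc a) (c ∷ zs))
  byCase (yes c<b) = begin
    insert a (insert b (c ∷ zs))                 ≡⟨ cong (insert a) (insert-pass zs c<b) ⟩
    insert a (c ∷ insert (suc b) zs)             ≡⟨ insert-pass (insert (suc b) zs) (<-trans c<b b<a) ⟩
    c ∷ insert (suc a) (insert (suc b) zs)       ≡⟨ cong (c ∷_) (insert-comm (suc a) (suc b) zs (s≤s b<a) (Linked.tail sorted)) ⟩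
    c ∷ insert (suc b) (insert (suc (suc a)) zs) ≡⟨ sym (insert-pass (insert (suc (suc a)) zs) c<b) ⟩
    insert b (c ∷ insert (suc (suc a)) zs)       ≡⟨ cong (insert b) (sym (insert-pass zs (<-trans c<b (<-trans b<a (n<1+n a))))) ⟩
    insert b (insert (suc a) (c ∷ zs))           ∎
  byCase (no c≮b) = begin
    insert a (insert b (c ∷ zs)) ≡⟨ cong (insert a) (insert-stop zs c≮b) ⟩
    insert a (b ∷ c ∷ zs)        ≡⟨ insert-pass (c ∷ zs) b<a ⟩
    b ∷ insert (suc a) (c ∷ zs)  ≡⟨ sym (insert-head b _ (insert-sorted (suc a) (c ∷ zs) (m≤n⇒m≤1+n (<⇒≤ b<a)) (≮⇒≥ c≮b ∷ sorted))) ⟩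
    insert b (insert (suc a) (c ∷ zs)) ∎

normalForm-switch : ∀ {x y} → Switch x y → normalForm x ≡ normalForm y
normalForm-switch (sw xs a b ys b<a) = underPrefix xs
  where
  underPrefix : ∀ xs → normalForm (xs ++ a ∷ b ∷ ys) ≡ normalForm (xs ++ b ∷ suc a ∷ ys)
  underPrefix []       = insert-comm a b (normalForm ys) b<a (normalForm-sorted ys)
  underPrefix (x ∷ xs) = cong (insert x) (underPrefix xs)

normalForm-switches-inv : ∀ {x y} → Switches x y → normalForm x ≡ normalForm y
normalForm-switches-inv ε        = refl
normalForm-switches-inv (s ◅ ss) = trans (normalForm-switch s) (normalForm-switches-inv ss)

normalOf-unique : ∀ x r → NormalOf x r → r ≡ normalForm x
normalOf-unique x r (x⇒r , sorted) =
  trans (sym (normalForm-sorted-id r sorted)) (sym (normalForm-switches-inv x⇒r))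

normalOf-exists : ∀ x → NormalOf x (normalForm x)
normalOf-exists x = normalForm-switches x , normalForm-sorted x

-- Positional bounds: the j-th entry (counting from 0) of a sequence lies in [1 , k+j+1].
-- For k = 0 these are the bounds 1 ≤ r_i ≤ i of an admissible sequence.
Bounded : ℕ → List ℕ → Set
Bounded k []       = ⊤
Bounded k (x ∷ xs) = (1 ≤ x × x ≤ suc k) × Bounded (suc k) xs

switch-bounded : ∀ {x y} k → Switch x y → Bounded k x → Bounded k y
switch-bounded k (sw xs a b ys b<a) = underPrefix k xs
  where
  underPrefix : ∀ k xs → Bounded k (xs ++ a ∷ b ∷ ys) → Bounded k (xs ++ b ∷ suc a ∷ ys)
  underPrefix k []       ((_ , a≤) , (1≤b , _) , rest) = (1≤b , ≤-trans (<⇒≤ b<a) a≤) , (s≤s z≤n , s≤s a≤) , rest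
  underPrefix k (x ∷ xs) (bx , rest)                 = bx , underPrefix (suc k) xs rest

switches-bounded : ∀ {x y} k → Switches x y → Bounded k x → Bounded k y
switches-bounded k ε        bounded = bounded
switches-bounded k (s ◅ ss) bounded = switches-bounded k ss (switch-bounded k s bounded)

switch-length : ∀ {x y} → Switch x y → length x ≡ length y
switch-length (sw xs a b ys _) = underPrefix xs
  where
  underPrefix : ∀ xs → length (xs ++ a ∷ b ∷ ys) ≡ length (xs ++ b ∷ suc a ∷ ys)
  underPrefix []       = refl
  underPrefix (x ∷ xs) = cong suc (underPrefix xs)

switches-length : ∀ {x y} → Switches x y → length x ≡ length y
switches-length ε        = refl
switches-length (s ◅ ss) = trans (switch-length s) (switches-length ss)

bounded⇒lookup : ∀ k r → Bounded k r → ∀ i → 1 ≤ lookup r i × lookup r i ≤ suc (k + toℕ i)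
bounded⇒lookup k (x ∷ r) ((1≤x , x≤) , _) fzero =
  1≤x , subst (λ m → x ≤ suc m) (sym (+-identityʳ k)) x≤
bounded⇒lookup k (x ∷ r) (_ , rest) (fsuc i) =
  let (1≤ , ≤k) = bounded⇒lookup (suc k) r rest i
  in 1≤ , subst (λ m → lookup r i ≤ suc m) (sym (+-suc k (toℕ i))) ≤k

lookup⇒bounded : ∀ k r → (∀ i → 1 ≤ lookup r i × lookup r i ≤ suc (k + toℕ i)) → Bounded k r
lookup⇒bounded k []      _      = tt
lookup⇒bounded k (x ∷ r) bounds =
  (proj₁ (bounds fzero) , subst (λ m → x ≤ suc m) (+-identityʳ k) (proj₂ (bounds fzero))) ,
  lookup⇒bounded (suc k) r λ i →
    proj₁ (bounds (fsuc i)) , subst (λ m → lookup r i ≤ suc m) (+-suc k (toℕ i)) (proj₂ (bounds (fsuc i)))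

bounded-snoc⁻ : ∀ k xs x → Bounded k (xs ∷ʳ x) → Bounded k xs × 1 ≤ x × x ≤ suc (k + length xs)
bounded-snoc⁻ k []       x ((1≤x , x≤) , _) = tt , 1≤x , subst (λ m → x ≤ suc m) (sym (+-identityʳ k)) x≤
bounded-snoc⁻ k (y ∷ ys) x (by , rest) =
  let (bys , 1≤x , x≤) = bounded-snoc⁻ (suc k) ys x rest
  in (by , bys) , 1≤x , subst (λ m → x ≤ suc m) (sym (+-suc k (length ys))) x≤

bounded-snoc⁺ : ∀ k xs x → Bounded k xs → 1 ≤ x → x ≤ suc (k + length xs) → Bounded k (xs ∷ʳ x)
bounded-snoc⁺ k []       x _           1≤x x≤ = (1≤x , subst (λ m → x ≤ suc m) (+-identityʳ k) x≤) , tt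
bounded-snoc⁺ k (y ∷ ys) x (by , bys) 1≤x x≤ =
  by , bounded-snoc⁺ (suc k) ys x bys 1≤x (subst (λ m → x ≤ suc m) (+-suc k (length ys)) x≤)

-- Admissible sequences of
-- length t are exactly the `AdmissibleFrom 1 1` ones.
AdmissibleFrom : ℕ → ℕ → List ℕ → Set
AdmissibleFrom hi lo []       = ⊤
AdmissibleFrom hi lo (x ∷ xs) = (lo ≤ x × x ≤ hi) × AdmissibleFrom (suc hi) x xs

admissibleFrom⇒sorted-bounded : ∀ k lo r → 1 ≤ lo → AdmissibleFrom (suc k) lo r → Nondecreasing r × Bounded k r
admissibleFrom⇒sorted-bounded k lo []          _    _ = [] , tt
admissibleFrom⇒sorted-bounded k lo (x ∷ [])    1≤lo ((lo≤x , x≤) , _) = [-] , (≤-trans 1≤lo lo≤x , x≤) , tt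
admissibleFrom⇒sorted-bounded k lo (x ∷ y ∷ r) 1≤lo ((lo≤x , x≤) , rest) =
  let (sorted , bounded) = admissibleFrom⇒sorted-bounded (suc k) x (y ∷ r) (≤-trans 1≤lo lo≤x) rest
  in proj₁ (proj₁ rest) ∷ sorted , (≤-trans 1≤lo lo≤x , x≤) , bounded

sorted-bounded⇒admissibleFrom : ∀ k lo r → Nondecreasing (lo ∷ r) → Bounded k r → AdmissibleFrom (suc k) lo r
sorted-bounded⇒admissibleFrom k lo []      _              _              = tt
sorted-bounded⇒admissibleFrom k lo (x ∷ r) (lo≤x ∷ sorted) ((_ , x≤) , b) =
  (lo≤x , x≤) , sorted-bounded⇒admissibleFrom (suc k) x r sorted b

length-snoc : ∀ (xs : List ℕ) x → length (xs ∷ʳ x) ≡ suc (length xs)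
length-snoc xs x = trans (length-++ xs) (+-comm (length xs) 1)

sorted-bounded⇒admissibleFrom₁ : ∀ r → Nondecreasing r → Bounded 0 r → AdmissibleFrom 1 1 r
sorted-bounded⇒admissibleFrom₁ []      _      _                        = tt
sorted-bounded⇒admissibleFrom₁ (x ∷ r) sorted bounded@((1≤x , _) , _) =
  sorted-bounded⇒admissibleFrom 0 1 (x ∷ r) (1≤x ∷ sorted) bounded

if-yes : ∀ {P : Set} {b} {A : Set} {x y : A} → Reflects P b → P → (if b then x else y) ≡ x
if-yes (ofʸ _)  _ = refl
if-yes (ofⁿ ¬p) p = ⊥-elim (¬p p)

if-no : ∀ {P : Set} {b} {A : Set} {x y : A} → Reflects P b → ¬ P → (if b then x else y) ≡ y
if-no (ofʸ p) ¬p = ⊥-elim (¬p p)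
if-no (ofⁿ _) _  = refl

≡ᵇ-reflects-≡ : ∀ m n → Reflects (m ≡ n) (m ≡ᵇ n)
≡ᵇ-reflects-≡ m n = fromEquivalence (≡ᵇ⇒≡ m n) (≡⇒≡ᵇ m n)

relabel-below : ∀ {s l} → l < s → relabel s l ≡ l
relabel-below {s} {l} l<s = if-yes (<ᵇ-reflects-< l s) l<s

relabel-above : ∀ {s l} → s ≤ l → relabel s l ≡ suc l
relabel-above {s} {l} s≤l = if-no (<ᵇ-reflects-< l s) (≤⇒≯ s≤l)

-- Vertex labels of the two copies.  Copy `false` is 𝒢⁺ and copy `true` is 𝒢⁻;
-- away from label s both copies relabel like relabel s.

copyLabel : ℕ → Bool → ℕ → ℕ
copyLabel s false l = relabel s l
copyLabel s true  l = if relabel s l ≡ᵇ suc s then s else relabel s l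

copyLabel-below : ∀ {s l} σ → l < s → copyLabel s σ l ≡ l
copyLabel-below false l<s = relabel-below l<s
copyLabel-below {s} {l} true l<s rewrite relabel-below l<s =
  if-no (≡ᵇ-reflects-≡ l (suc s)) λ l≡1+s → <-irrefl l≡1+s (<-trans l<s (n<1+n s))

copyLabel-above : ∀ {s l} σ → s < l → copyLabel s σ l ≡ suc l
copyLabel-above false s<l = relabel-above (<⇒≤ s<l)
copyLabel-above {s} {l} true s<l rewrite relabel-above (<⇒≤ s<l) =
  if-no (≡ᵇ-reflects-≡ (suc l) (suc s)) λ e → <-irrefl (sym (suc-injective e)) s<l

copyLabel⁺-at : ∀ s → copyLabel s false s ≡ suc s
copyLabel⁺-at s = relabel-above ≤-refl

copyLabel⁻-at : ∀ s → copyLabel s true s ≡ s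
copyLabel⁻-at s rewrite relabel-above {s} ≤-refl = if-yes (≡ᵇ-reflects-≡ (suc s) (suc s)) refl

copyLabel⁺-inv : ∀ s l → copyLabel s false l ≡ suc s → l ≡ s
copyLabel⁺-inv s l e with <-cmp l s
... | tri< l<s _ _ = ⊥-elim (<-irrefl (trans (sym (relabel-below l<s)) e) (<-trans l<s (n<1+n s)))
... | tri≈ _ l≡s _ = l≡s
... | tri> _ _ s<l = ⊥-elim (<-irrefl (sym (suc-injective (trans (sym (relabel-above (<⇒≤ s<l))) e))) s<l)

ι : ∀ {n} → Bool → Fin n → Fin (n + n)
ι {n} false x = x ↑ˡ n
ι {n} true  x = n ↑ʳ x

decode : ∀ {n} → Fin (n + n) → Bool × Fin n
decode {n} i = [ (false ,_) , (true ,_) ]′ (splitAt n i)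

decode-ι : ∀ {n} σ (x : Fin n) → decode (ι σ x) ≡ (σ , x)
decode-ι {n} false x rewrite splitAt-↑ˡ n x n = refl
decode-ι {n} true  x rewrite splitAt-↑ʳ n n x = refl

ι-injective : ∀ {n σ τ} {x y : Fin n} → ι σ x ≡ ι τ y → σ ≡ τ × x ≡ y
ι-injective {n} {σ} {τ} {x} {y} e
  with trans (sym (decode-ι σ x)) (trans (cong decode e) (decode-ι τ y))
... | refl = refl , refl

data Coords {n : ℕ} : Fin (n + n) → Set where
  coords : ∀ σ (x : Fin n) → Coords (ι σ x)

coordsOf : ∀ {n} (i : Fin (n + n)) → Coords i
coordsOf {n} i with splitAt n i in eq
... | inj₁ x = subst Coords (splitAt⁻¹-↑ˡ eq) (coords false x)
... | inj₂ x = subst Coords (splitAt⁻¹-↑ʳ eq) (coords true x)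

lab-double : ∀ s G σ x → lab (double s G) (ι σ x) ≡ copyLabel s σ (lab G x)
lab-double s G false x rewrite splitAt-↑ˡ (V G) x (V G) = refl
lab-double s G true  x rewrite splitAt-↑ʳ (V G) (V G) x = refl

data DoubledEdge (s : ℕ) (G : LGraph) : Fin (V G + V G) → Fin (V G + V G) → ℕ → Set where
  copy  : ∀ σ {x y ℓ} → (x , y , ℓ) ∈ edges G → DoubledEdge s G (ι σ x) (ι σ y) (relabel s ℓ)
  match : ∀ {x} → lab G x ≡ s → DoubledEdge s G (ι false x) (ι true x) s

matchingEdges : ∀ s G → Fin (V G) → List (Fin (V G + V G) × Fin (V G + V G) × ℕ)
matchingEdges s G v = if relabel s (lab G v) ≡ᵇ suc s then [ (v ↑ˡ V G , V G ↑ʳ v , s) ] else []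

doubledEdge⁻ : ∀ s G {u v ℓ} → (u , v , ℓ) ∈ edges (double s G) → DoubledEdge s G u v ℓ
doubledEdge⁻ s G e∈ with ∈-++⁻ (map _ (edges G)) e∈
... | inj₁ e∈⁺ with ∈-map⁻ _ e∈⁺
...   | _ , e∈G , refl = copy false e∈G
doubledEdge⁻ s G e∈ | inj₂ e∈⁻ with ∈-++⁻ (map _ (edges G)) e∈⁻
... | inj₁ e∈⁻' with ∈-map⁻ _ e∈⁻'
...   | _ , e∈G , refl = copy true e∈G
doubledEdge⁻ s G e∈ | inj₂ _ | inj₂ e∈m with ∈-concat⁻′ (map (matchingEdges s G) (allFin (V G))) e∈m
... | _ , e∈w , w∈ with ∈-map⁻ (matchingEdges s G) w∈
...   | w , _ , refl with relabel s (lab G w) ≡ᵇ suc s | ≡ᵇ-reflects-≡ (relabel s (lab G w)) (suc s) | e∈w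
...     | true | ofʸ lw | here refl = match (copyLabel⁺-inv s (lab G w) lw)

doubledEdge⁺ : ∀ s G {u v ℓ} → DoubledEdge s G u v ℓ → (u , v , ℓ) ∈ edges (double s G)
doubledEdge⁺ s G (copy false e∈G) = ∈-++⁺ˡ (∈-map⁺ _ e∈G)
doubledEdge⁺ s G (copy true e∈G)  = ∈-++⁺ʳ (map _ (edges G)) (∈-++⁺ˡ (∈-map⁺ _ e∈G))
doubledEdge⁺ s G (match {w} lw) =
  ∈-++⁺ʳ (map _ (edges G)) (∈-++⁺ʳ (map _ (edges G)) (∈-concat⁺′ e∈w (∈-map⁺ (matchingEdges s G) (∈-allFin w))))
  where
  lw⁺ : relabel s (lab G w) ≡ suc s
  lw⁺ = trans (cong (relabel s) lw) (copyLabel⁺-at s)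
  e∈w : (w ↑ˡ V G , V G ↑ʳ w , s) ∈ matchingEdges s G w
  e∈w = subst ((w ↑ˡ V G , V G ↑ʳ w , s) ∈_) (sym (if-yes (≡ᵇ-reflects-≡ _ (suc s)) lw⁺)) (here refl)

data DoubledAdj (s : ℕ) (G : LGraph) : Bool → Bool → Fin (V G) → Fin (V G) → ℕ → Set where
  within : ∀ σ {x y ℓ} → Adj G x y ℓ → DoubledAdj s G σ σ x y (relabel s ℓ)
  across : ∀ {σ τ x} → σ ≢ τ → lab G x ≡ s → DoubledAdj s G σ τ x x s

private
  edgeCoords : ∀ {s G σ τ x y ℓ u v} → DoubledEdge s G u v ℓ → u ≡ ι σ x → v ≡ ι τ y →
    (σ ≡ τ × Σ ℕ λ ℓ' → relabel s ℓ' ≡ ℓ × (x , y , ℓ') ∈ edges G) ⊎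
    (σ ≡ false × τ ≡ true × x ≡ y × lab G x ≡ s × ℓ ≡ s)
  edgeCoords {σ = σ} {τ} {x} {y} (copy σ' {x'} {y'} e∈G) eu ev
    with ι-injective {σ = σ'} {σ} {x'} {x} eu | ι-injective {σ = σ'} {τ} {y'} {y} ev
  ... | refl , refl | refl , refl = inj₁ (refl , _ , refl , e∈G)
  edgeCoords {σ = σ} {τ} {x} {y} (match {w} lw) eu ev
    with ι-injective {σ = false} {σ} {w} {x} eu | ι-injective {σ = true} {τ} {w} {y} ev
  ... | refl , refl | refl , refl = inj₂ (refl , refl , refl , lw , refl)

doubledAdj⁻ : ∀ s G σ τ x y ℓ → Adj (double s G) (ι σ x) (ι τ y) ℓ → DoubledAdj s G σ τ x y ℓ
doubledAdj⁻ s G σ τ x y ℓ (inj₁ e∈) with edgeCoords {σ = σ} {τ} {x} {y} (doubledEdge⁻ s G e∈) refl refl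
... | inj₁ (refl , _ , refl , e∈G)        = within σ (inj₁ e∈G)
... | inj₂ (refl , refl , refl , lx , refl) = across (λ ()) lx
doubledAdj⁻ s G σ τ x y ℓ (inj₂ e∈) with edgeCoords {σ = τ} {σ} {y} {x} (doubledEdge⁻ s G e∈) refl refl
... | inj₁ (refl , _ , refl , e∈G)        = within σ (inj₂ e∈G)
... | inj₂ (refl , refl , refl , ly , refl) = across (λ ()) ly

doubledAdj⁺ : ∀ s G {σ τ x y ℓ} → DoubledAdj s G σ τ x y ℓ → Adj (double s G) (ι σ x) (ι τ y) ℓ
doubledAdj⁺ s G (within σ (inj₁ e∈G)) = inj₁ (doubledEdge⁺ s G (copy σ e∈G))
doubledAdj⁺ s G (within σ (inj₂ e∈G)) = inj₂ (doubledEdge⁺ s G (copy σ e∈G))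
doubledAdj⁺ s G (across {false} {true}  _ lx) = inj₁ (doubledEdge⁺ s G (match lx))
doubledAdj⁺ s G (across {true}  {false} _ lx) = inj₂ (doubledEdge⁺ s G (match lx))
doubledAdj⁺ s G (across {false} {false} σ≢τ _) = ⊥-elim (σ≢τ refl)
doubledAdj⁺ s G (across {true}  {true}  σ≢τ _) = ⊥-elim (σ≢τ refl)

record _≅_ (G H : LGraph) : Set where
  field
    to            : Fin (V G) → Fin (V H)
    from          : Fin (V H) → Fin (V G)
    to-from       : ∀ y → to (from y) ≡ y
    from-to       : ∀ x → from (to x) ≡ x
    preserves-lab : ∀ v → lab H (to v) ≡ lab G v
    preserves-adj : ∀ {u v ℓ} → Adj G u v ℓ → Adj H (to u) (to v) ℓ
    reflects-adj  : ∀ {u v ℓ} → Adj H (to u) (to v) ℓ → Adj G u v ℓ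
open _≅_ public

mk≅ : ∀ {G H} (f : Fin (V G) → Fin (V H)) (g : Fin (V H) → Fin (V G)) →
  (∀ y → f (g y) ≡ y) → (∀ x → g (f x) ≡ x) → (∀ v → lab H (f v) ≡ lab G v) →
  (∀ {u v ℓ} → Adj G u v ℓ → Adj H (f u) (f v) ℓ) →
  (∀ {u v ℓ} → Adj H u v ℓ → Adj G (g u) (g v) ℓ) → G ≅ H
mk≅ {G} f g fg gf labs adj→ adj← = record
  { to = f ; from = g ; to-from = fg ; from-to = gf ; preserves-lab = labs ; preserves-adj = adj→
  ; reflects-adj = λ {u} {v} {ℓ} a → subst₂ (λ p q → Adj G p q ℓ) (gf u) (gf v) (adj← a) }

≅⇒Iso : ∀ {G H} → G ≅ H → Iso G H
≅⇒Iso I = mk↔ₛ′ (to I) (from I) (to-from I) (from-to I) , preserves-lab I ,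
          λ u v ℓ → mk⇔ (preserves-adj I) (reflects-adj I)

Iso⇒≅ : ∀ {G H} → Iso G H → G ≅ H
Iso⇒≅ (f , labs , adj) = record
  { to = Inverse.to f ; from = Inverse.from f
  ; to-from = λ _ → Inverse.inverseˡ f refl ; from-to = λ _ → Inverse.inverseʳ f refl
  ; preserves-lab = labs
  ; preserves-adj = λ {u} {v} {ℓ} → Equivalence.to (adj u v ℓ)
  ; reflects-adj = λ {u} {v} {ℓ} → Equivalence.from (adj u v ℓ) }

≅-refl : ∀ {G} → G ≅ G
≅-refl = mk≅ (λ x → x) (λ x → x) (λ _ → refl) (λ _ → refl) (λ _ → refl) (λ a → a) (λ a → a)

≡⇒≅ : ∀ {G H} → G ≡ H → G ≅ H
≡⇒≅ refl = ≅-refl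

≅-sym : ∀ {G H} → G ≅ H → H ≅ G
≅-sym {G} {H} I = mk≅ (from I) (to I) (from-to I) (to-from I) labs
  (λ {u} {v} {ℓ} a → reflects-adj I (subst₂ (λ p q → Adj H p q ℓ) (sym (to-from I u)) (sym (to-from I v)) a))
  (preserves-adj I)
  where
  labs : ∀ v → lab G (from I v) ≡ lab H v
  labs v = trans (sym (preserves-lab I (from I v))) (cong (lab H) (to-from I v))

≅-trans : ∀ {G H K} → G ≅ H → H ≅ K → G ≅ K
≅-trans I J = mk≅ (λ x → to J (to I x)) (λ z → from I (from J z))
  (λ z → trans (cong (to J) (to-from I (from J z))) (to-from J z))
  (λ x → trans (cong (from I) (from-to J (to I x))) (from-to I x))
  (λ v → trans (preserves-lab J (to I v)) (preserves-lab I v))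
  (λ a → preserves-adj J (preserves-adj I a))
  (λ a → preserves-adj (≅-sym I) (preserves-adj (≅-sym J) a))

onCopies : ∀ {n m} → (Fin n → Fin m) → Fin (n + n) → Fin (m + m)
onCopies {n} f i = ι (proj₁ (decode {n} i)) (f (proj₂ (decode {n} i)))

onCopies-ι : ∀ {n m} (f : Fin n → Fin m) σ x → onCopies f (ι σ x) ≡ ι σ (f x)
onCopies-ι f σ x rewrite decode-ι σ x = refl

onCopies-inverse : ∀ {n m} (f : Fin n → Fin m) (g : Fin m → Fin n) → (∀ x → g (f x) ≡ x) →
  ∀ i → onCopies g (onCopies f i) ≡ i
onCopies-inverse {n} f g gf i with coordsOf {n} i
... | coords σ x rewrite onCopies-ι f σ x | onCopies-ι g σ (f x) | gf x = refl

doubledAdj-map : ∀ {s G H σ τ x y ℓ} (I : G ≅ H) → DoubledAdj s G σ τ x y ℓ → DoubledAdj s H σ τ (to I x) (to I y) ℓ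
doubledAdj-map I (within σ a)    = within σ (preserves-adj I a)
doubledAdj-map I (across σ≢τ lx) = across σ≢τ (trans (preserves-lab I _) lx)

double-adj : ∀ {G H} s (I : G ≅ H) {u v ℓ} → Adj (double s G) u v ℓ →
  Adj (double s H) (onCopies (to I) u) (onCopies (to I) v) ℓ
double-adj {G} {H} s I {u} {v} {ℓ} a with coordsOf {V G} u | coordsOf {V G} v
... | coords σ x | coords τ y rewrite onCopies-ι (to I) σ x | onCopies-ι (to I) τ y =
  doubledAdj⁺ s H (doubledAdj-map I (doubledAdj⁻ s G σ τ x y ℓ a))

double-≅ : ∀ {G H} s → G ≅ H → double s G ≅ double s H
double-≅ {G} {H} s I = mk≅ (onCopies (to I)) (onCopies (from I))
  (onCopies-inverse (from I) (to I) (to-from I)) (onCopies-inverse (to I) (from I) (from-to I))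
  labs (double-adj s I) (double-adj s (≅-sym I))
  where
  labs : ∀ v → lab (double s H) (onCopies (to I) v) ≡ lab (double s G) v
  labs v with coordsOf {V G} v
  ... | coords σ x rewrite onCopies-ι (to I) σ x | lab-double s H σ (to I x) | lab-double s G σ x =
    cong (copyLabel s σ) (preserves-lab I x)

copyLabel-≥ : ∀ s σ l → l ≤ copyLabel s σ l
copyLabel-≥ s σ l with <-cmp l s
... | tri< l<s _ _ = subst (l ≤_) (sym (copyLabel-below σ l<s)) ≤-refl
... | tri> _ _ s<l = subst (l ≤_) (sym (copyLabel-above σ s<l)) (n≤1+n l)
copyLabel-≥ s false l | tri≈ _ refl _ = subst (l ≤_) (sym (copyLabel⁺-at l)) (n≤1+n l)
copyLabel-≥ s true  l | tri≈ _ refl _ = subst (l ≤_) (sym (copyLabel⁻-at l)) ≤-refl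

copyLabel-≤ : ∀ s σ l → copyLabel s σ l ≤ suc l
copyLabel-≤ s σ l with <-cmp l s
... | tri< l<s _ _ = subst (_≤ suc l) (sym (copyLabel-below σ l<s)) (n≤1+n l)
... | tri> _ _ s<l = subst (_≤ suc l) (sym (copyLabel-above σ s<l)) ≤-refl
copyLabel-≤ s false l | tri≈ _ refl _ = subst (_≤ suc l) (sym (copyLabel⁺-at l)) ≤-refl
copyLabel-≤ s true  l | tri≈ _ refl _ = subst (_≤ suc l) (sym (copyLabel⁻-at l)) (n≤1+n l)

copyLabel-below-inv : ∀ {s m} σ l → m < s → copyLabel s σ l ≡ m → l ≡ m
copyLabel-below-inv {s} σ l m<s e with <-cmp l s
... | tri< l<s _ _ = trans (sym (copyLabel-below σ l<s)) e
... | tri≈ _ l≡s _ = ⊥-elim (<-irrefl refl (<-≤-trans m<s (subst₂ _≤_ l≡s e (copyLabel-≥ s σ l))))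
... | tri> _ _ s<l = ⊥-elim (<-irrefl refl (<-≤-trans m<s (≤-trans (<⇒≤ s<l) (subst (l ≤_) e (copyLabel-≥ s σ l)))))

copyLabel-above-inv : ∀ {s m} σ l → s < m → copyLabel s σ l ≡ suc m → l ≡ m
copyLabel-above-inv {s} σ l s<m e with <-cmp s l
... | tri< s<l _ _ = suc-injective (trans (sym (copyLabel-above σ s<l)) e)
... | tri≈ _ refl _ = ⊥-elim (<-irrefl refl (<-≤-trans (s≤s s<m) (subst (_≤ suc l) e (copyLabel-≤ s σ l))))
... | tri> _ _ l<s = ⊥-elim (<-irrefl refl (<-≤-trans (s≤s (<-trans l<s s<m)) (subst (_≤ suc l) e (copyLabel-≤ s σ l))))

copyLabel-comm : ∀ {a b} σa σb l → b < a →
  copyLabel b σb (copyLabel a σa l) ≡ copyLabel (suc a) σa (copyLabel b σb l)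
copyLabel-comm {a} {b} σa σb l b<a with <-cmp l b
... | tri< l<b _ _
  rewrite copyLabel-below σa (<-trans l<b b<a) | copyLabel-below σb l<b =
  sym (copyLabel-below σa (<-trans l<b (<-trans b<a (n<1+n a))))
... | tri≈ _ refl _ rewrite copyLabel-below σa b<a =
  sym (copyLabel-below σa (s≤s (≤-trans (copyLabel-≤ l σb l) b<a)))
... | tri> _ _ b<l with <-cmp l a
...   | tri< l<a _ _ rewrite copyLabel-below σa l<a | copyLabel-above σb b<l =
  sym (copyLabel-below σa (s≤s l<a))
...   | tri> _ _ a<l rewrite copyLabel-above σa a<l | copyLabel-above σb b<l
                           | copyLabel-above σb (<-trans b<l (n<1+n l)) =
  sym (copyLabel-above σa (s≤s a<l))
...   | tri≈ _ refl _ rewrite copyLabel-above σb b<l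
                            | copyLabel-above σb (<-≤-trans b<a (copyLabel-≥ l σa l)) = atA σa
  where
  atA : ∀ σ → suc (copyLabel l σ l) ≡ copyLabel (suc l) σ (suc l)
  atA false = trans (cong suc (copyLabel⁺-at l)) (sym (copyLabel⁺-at (suc l)))
  atA true  = trans (cong suc (copyLabel⁻-at l)) (sym (copyLabel⁻-at (suc l)))

-- For b < a, doubling at a then at b gives the same graph as doubling at b
-- then at a+1, up to exchanging the two copy coordinates.  This is the
-- graph-theoretic content of a switch (a , b) ↦ (b , a+1).
module Commutation (G : LGraph) {a b : ℕ} (b<a : b < a) where

  private
    n : ℕ
    n = V G
    A B : LGraph
    A = double a G
    B = double b G

  exchange : Fin ((n + n) + (n + n)) → Fin ((n + n) + (n + n))
  exchange i = ι (proj₁ (decode {n} (proj₂ (decode {n + n} i))))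
                 (ι (proj₁ (decode {n + n} i)) (proj₂ (decode {n} (proj₂ (decode {n + n} i)))))

  exchange-ι : ∀ σ τ (x : Fin n) → exchange (ι σ (ι τ x)) ≡ ι τ (ι σ x)
  exchange-ι σ τ x rewrite decode-ι {n + n} σ (ι τ x) | decode-ι τ x = refl

  exchange-involutive : ∀ i → exchange (exchange i) ≡ i
  exchange-involutive i with coordsOf {n + n} i
  ... | coords σ j with coordsOf {n} j
  ...   | coords τ x rewrite exchange-ι σ τ x = exchange-ι τ σ x

  private
    adj₁₂ : ∀ {σb τb j k ℓ} → DoubledAdj b A σb τb j k ℓ →
      Adj (double (suc a) B) (exchange (ι σb j)) (exchange (ι τb k)) ℓ
    adj₁₂ {σb} {τb} {j} {k} (within _ {ℓ = ℓ'} adjA) with coordsOf {n} j | coordsOf {n} k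
    ... | coords σa x | coords τa y
      rewrite exchange-ι σb σa x | exchange-ι σb τa y with doubledAdj⁻ a G σa τa x y ℓ' adjA
    ...   | within _ {ℓ = m} adjG =
      subst (Adj (double (suc a) B) _ _) (sym (copyLabel-comm false false m b<a))
        (doubledAdj⁺ (suc a) B (within σa (doubledAdj⁺ b G (within σb adjG))))
    ...   | across σa≢τa lx =
      subst (Adj (double (suc a) B) _ _) (sym (relabel-above (<⇒≤ b<a)))
        (doubledAdj⁺ (suc a) B (across σa≢τa (trans (lab-double b G σb x) (trans (cong (copyLabel b σb) lx) (copyLabel-above σb b<a)))))
    adj₁₂ {σb} {τb} {j} (across σb≢τb lj) with coordsOf {n} j
    ... | coords σa x rewrite exchange-ι σb σa x | exchange-ι τb σa x =
      subst (Adj (double (suc a) B) _ _) (relabel-below (<-trans b<a (n<1+n a)))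
        (doubledAdj⁺ (suc a) B (within σa (doubledAdj⁺ b G (across σb≢τb lx))))
      where
      lx : lab G x ≡ b
      lx = copyLabel-below-inv σa (lab G x) b<a (trans (sym (lab-double a G σa x)) lj)

    adj₂₁ : ∀ {σa τa j k ℓ} → DoubledAdj (suc a) B σa τa j k ℓ →
      Adj (double b A) (exchange (ι σa j)) (exchange (ι τa k)) ℓ
    adj₂₁ {σa} {τa} {j} {k} (within _ {ℓ = ℓ'} adjB) with coordsOf {n} j | coordsOf {n} k
    ... | coords σb x | coords τb y
      rewrite exchange-ι σa σb x | exchange-ι σa τb y with doubledAdj⁻ b G σb τb x y ℓ' adjB
    ...   | within _ {ℓ = m} adjG =
      subst (Adj (double b A) _ _) (copyLabel-comm false false m b<a)
        (doubledAdj⁺ b A (within σb (doubledAdj⁺ a G (within σa adjG))))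
    ...   | across σb≢τb lx =
      subst (Adj (double b A) _ _) (sym (relabel-below (<-trans b<a (n<1+n a))))
        (doubledAdj⁺ b A (across σb≢τb (trans (lab-double a G σa x) (trans (cong (copyLabel a σa) lx) (copyLabel-below σa b<a)))))
    adj₂₁ {σa} {τa} {j} (across σa≢τa lj) with coordsOf {n} j
    ... | coords σb x rewrite exchange-ι σa σb x | exchange-ι τa σb x =
      subst (Adj (double b A) _ _) (relabel-above (<⇒≤ b<a))
        (doubledAdj⁺ b A (within σb (doubledAdj⁺ a G (across σa≢τa lx))))
      where
      lx : lab G x ≡ a
      lx = copyLabel-above-inv σb (lab G x) b<a (trans (sym (lab-double b G σb x)) lj)

    labels : ∀ v → lab (double (suc a) B) (exchange v) ≡ lab (double b A) v
    labels v with coordsOf {n + n} v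
    ... | coords σb j with coordsOf {n} j
    ...   | coords σa x
      rewrite exchange-ι σb σa x | lab-double (suc a) B σa (ι σb x) | lab-double b G σb x
            | lab-double b A σb (ι σa x) | lab-double a G σa x =
      sym (copyLabel-comm σa σb (lab G x) b<a)

  double-comm : double b (double a G) ≅ double (suc a) (double b G)
  double-comm = mk≅ exchange exchange exchange-involutive exchange-involutive labels adj→ adj←
    where
    adj→ : ∀ {u v ℓ} → Adj (double b A) u v ℓ → Adj (double (suc a) B) (exchange u) (exchange v) ℓ
    adj→ {u} {v} {ℓ} adj with coordsOf {n + n} u | coordsOf {n + n} v
    ... | coords σ j | coords τ k = adj₁₂ (doubledAdj⁻ b A σ τ j k ℓ adj)
    adj← : ∀ {u v ℓ} → Adj (double (suc a) B) u v ℓ → Adj (double b A) (exchange u) (exchange v) ℓ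
    adj← {u} {v} {ℓ} adj with coordsOf {n + n} u | coordsOf {n + n} v
    ... | coords σ j | coords τ k = adj₂₁ (doubledAdj⁻ (suc a) B σ τ j k ℓ adj)

open Commutation using (double-comm) public

point : LGraph
point = record { V = 1 ; lab = λ _ → 1 ; edges = [] }

doubleAll : LGraph → List ℕ → LGraph
doubleAll = foldl (λ G s → double s G)

seqGraph : List ℕ → LGraph
seqGraph = doubleAll point

seqGraph-snoc : ∀ xs x → seqGraph (xs ∷ʳ x) ≡ double x (seqGraph xs)
seqGraph-snoc xs x = foldl-++ (λ G s → double s G) point xs [ x ]

doubleAll-≅ : ∀ {G H} ys → G ≅ H → doubleAll G ys ≅ doubleAll H ys
doubleAll-≅ []       I = I
doubleAll-≅ (y ∷ ys) I = doubleAll-≅ ys (double-≅ y I)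

switch-≅ : ∀ {x y} → Switch x y → seqGraph x ≅ seqGraph y
switch-≅ (sw xs a b ys b<a) =
  ≅-trans (≡⇒≅ (foldl-++ (λ G s → double s G) point xs (a ∷ b ∷ ys)))
  (≅-trans (doubleAll-≅ ys (double-comm (seqGraph xs) b<a))
           (≡⇒≅ (sym (foldl-++ (λ G s → double s G) point xs (b ∷ suc a ∷ ys)))))

switches-≅ : ∀ {x y} → Switches x y → seqGraph x ≅ seqGraph y
switches-≅ ε        = ≅-refl
switches-≅ (s ◅ ss) = ≅-trans (switch-≅ s) (switches-≅ ss)

δ : ℕ → ℕ → ℕ
δ a b = if a ≡ᵇ b then 1 else 0

δ-cong : ∀ {a ℓ b m} → (a ≡ ℓ → b ≡ m) → (b ≡ m → a ≡ ℓ) → δ a ℓ ≡ δ b m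
δ-cong {a} {ℓ} {b} {m} to from with a ≡ᵇ ℓ | ≡ᵇ-reflects-≡ a ℓ | b ≡ᵇ m | ≡ᵇ-reflects-≡ b m
... | true  | _       | true  | _       = refl
... | false | _       | false | _       = refl
... | true  | ofʸ a≡ℓ | false | ofⁿ b≢m = ⊥-elim (b≢m (to a≡ℓ))
... | false | ofⁿ a≢ℓ | true  | ofʸ b≡m = ⊥-elim (a≢ℓ (from b≡m))

δ-≢ : ∀ {a ℓ} → a ≢ ℓ → δ a ℓ ≡ 0
δ-≢ {a} {ℓ} a≢ℓ = if-no (≡ᵇ-reflects-≡ a ℓ) a≢ℓ

count : LGraph → ℕ → ℕ
count G ℓ = sum (λ v → δ (lab G v) ℓ)

count-≅ : ∀ {G H} → G ≅ H → ∀ ℓ → count H ℓ ≡ count G ℓ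
count-≅ {G} {H} I ℓ =
  trans (∑-permute (λ v → δ (lab H v) ℓ) (proj₁ (≅⇒Iso I)))
        (sum-cong-≗ λ v → cong (λ l → δ l ℓ) (preserves-lab I v))

sum-++ : ∀ {m n} (f : Vector ℕ m) (g : Vector ℕ n) → sum (f ++ᵛ g) ≡ sum f + sum g
sum-++ {zero}  f g = refl
sum-++ {suc m} f g =
  trans (cong (f fzero +_) (trans (sum-cong-≗ tail-++) (sum-++ (tail f) g))) (sym (+-assoc (f fzero) _ _))
  where
  tail-++ : tail (f ++ᵛ g) ≗ tail f ++ᵛ g
  tail-++ i with splitAt m i
  ... | inj₁ _ = refl
  ... | inj₂ _ = refl

sum-zero : ∀ {n} (f : Vector ℕ n) → (∀ i → f i ≡ 0) → sum f ≡ 0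
sum-zero {n} f f≡0 = trans (sum-cong-≗ f≡0) (sum-replicate-zero n)

count-double : ∀ s G ℓ → count (double s G) ℓ ≡
  sum (λ x → δ (copyLabel s false (lab G x)) ℓ) + sum (λ x → δ (copyLabel s true (lab G x)) ℓ)
count-double s G ℓ = trans (sum-cong-≗ bySplit) (sum-++ (λ x → δ (copyLabel s false (lab G x)) ℓ) _)
  where
  bySplit : (λ v → δ (lab (double s G) v) ℓ) ≗
            (λ x → δ (copyLabel s false (lab G x)) ℓ) ++ᵛ (λ x → δ (copyLabel s true (lab G x)) ℓ)
  bySplit i with splitAt (V G) i
  ... | inj₁ _ = refl
  ... | inj₂ _ = refl

count-double-below : ∀ {s ℓ} G → ℓ < s → count (double s G) ℓ ≡ count G ℓ + count G ℓ
count-double-below {s} {ℓ} G ℓ<s =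
  trans (count-double s G ℓ) (cong₂ _+_ (sum-cong-≗ λ x → same false (lab G x)) (sum-cong-≗ λ x → same true (lab G x)))
  where
  same : ∀ σ l → δ (copyLabel s σ l) ℓ ≡ δ l ℓ
  same σ l = δ-cong (copyLabel-below-inv σ l ℓ<s) (λ { refl → copyLabel-below σ ℓ<s })

count-double-above : ∀ {s m} G → s < m → count (double s G) (suc m) ≡ count G m + count G m
count-double-above {s} {m} G s<m =
  trans (count-double s G (suc m)) (cong₂ _+_ (sum-cong-≗ λ x → same false (lab G x)) (sum-cong-≗ λ x → same true (lab G x)))
  where
  same : ∀ σ l → δ (copyLabel s σ l) (suc m) ≡ δ l m
  same σ l = δ-cong (copyLabel-above-inv σ l s<m) (λ { refl → copyLabel-above σ s<m })

count-double-at : ∀ s G → count (double s G) s ≡ count G s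
count-double-at s G =
  trans (count-double s G s) (cong₂ _+_ (sum-zero _ λ x → δ-≢ (missed (lab G x))) (sum-cong-≗ λ x → kept (lab G x)))
  where
  missed : ∀ l → copyLabel s false l ≢ s
  missed l e with <-cmp l s
  ... | tri< l<s _ _ = <-irrefl (trans (sym (copyLabel-below false l<s)) e) l<s
  ... | tri≈ _ refl _ = <-irrefl (sym (trans (sym (copyLabel⁺-at l)) e)) (n<1+n l)
  ... | tri> _ _ s<l = <-irrefl (sym (trans (sym (copyLabel-above false s<l)) e)) (<-trans s<l (n<1+n l))
  kept : ∀ l → δ (copyLabel s true l) s ≡ δ l s
  kept l = δ-cong (onlyAt l) λ { refl → copyLabel⁻-at s }
    where
    onlyAt : ∀ l → copyLabel s true l ≡ s → l ≡ s
    onlyAt l e with <-cmp l s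
    ... | tri< l<s _ _ = trans (sym (copyLabel-below true l<s)) e
    ... | tri≈ _ l≡s _ = l≡s
    ... | tri> _ _ s<l = ⊥-elim (<-irrefl (sym (trans (sym (copyLabel-above true s<l)) e)) (<-trans s<l (n<1+n l)))

count-double-next : ∀ s G → count (double s G) (suc s) ≡ count G s
count-double-next s G =
  trans (count-double s G (suc s))
  (trans (cong₂ _+_ (sum-cong-≗ λ x → lifted (lab G x)) (sum-zero _ λ x → δ-≢ (missed (lab G x))))
         (+-identityʳ (count G s)))
  where
  lifted : ∀ l → δ (copyLabel s false l) (suc s) ≡ δ l s
  lifted l = δ-cong (copyLabel⁺-inv s l) λ { refl → copyLabel⁺-at s }
  missed : ∀ l → copyLabel s true l ≢ suc s
  missed l e with <-cmp l s
  ... | tri< l<s _ _ = <-irrefl (trans (sym (copyLabel-below true l<s)) e) (<-trans l<s (n<1+n s))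
  ... | tri≈ _ refl _ = <-irrefl (trans (sym (copyLabel⁻-at l)) e) (n<1+n l)
  ... | tri> _ _ s<l = <-irrefl (sym (suc-injective (trans (sym (copyLabel-above true s<l)) e))) s<l

lastOf : ℕ → List ℕ → ℕ
lastOf lo []       = lo
lastOf lo (y ∷ ys) = lastOf y ys

lastOf-snoc : ∀ lo xs x → lastOf lo (xs ∷ʳ x) ≡ x
lastOf-snoc lo []       x = refl
lastOf-snoc lo (y ∷ ys) x = lastOf-snoc y ys x

lastOf-≥ : ∀ hi lo ys → AdmissibleFrom hi lo ys → lo ≤ lastOf lo ys
lastOf-≥ hi lo []       _                = ≤-refl
lastOf-≥ hi lo (y ∷ ys) ((lo≤y , _) , a) = ≤-trans lo≤y (lastOf-≥ (suc hi) y ys a)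

admissibleFrom-snoc : ∀ hi lo xs x → AdmissibleFrom hi lo (xs ∷ʳ x) →
  AdmissibleFrom hi lo xs × lastOf lo xs ≤ x × x ≤ hi + length xs
admissibleFrom-snoc hi lo [] x ((lo≤x , x≤hi) , _) = tt , lo≤x , subst (x ≤_) (sym (+-identityʳ hi)) x≤hi
admissibleFrom-snoc hi lo (y ∷ ys) x (head , rest) =
  let (a , last≤x , x≤) = admissibleFrom-snoc (suc hi) y ys x rest
  in (head , a) , last≤x , subst (x ≤_) (sym (+-suc hi (length ys))) x≤

-- The label counts of the graph of an admissible sequence ending in s,
-- with t entries: every label 1 … t+1 occurs, labels s and s+1 occur
-- equally often, and above s the counts strictly increase up to t+1.
-- This profile determines s, which is what makes r ↦ counts injective.

record Profile (G : LGraph) (t s : ℕ) : Set where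
  field
    occurs     : ∀ ℓ → 1 ≤ ℓ → ℓ ≤ suc t → 0 < count G ℓ
    balanced   : count G s ≡ count G (suc s)
    increasing : ∀ ℓ → s < ℓ → ℓ ≤ t → count G ℓ < count G (suc ℓ)
open Profile

private
  <-double : ∀ {a} → 0 < a → a < a + a
  <-double {suc a} _ = s≤s (subst (suc a ≤_) (sym (+-suc a a)) (s≤s (m≤m+n a a)))

  subst< : ∀ {a b c d} → a ≡ b → c ≡ d → a < c → b < d
  subst< = subst₂ _<_

profile-base : Profile (double 1 point) 1 1
profile-base = record
  { occurs     = occurs₁
  ; balanced   = trans (count-double-at 1 point) (sym (count-double-next 1 point))
  ; increasing = λ ℓ 1<ℓ ℓ≤1 → ⊥-elim (<-irrefl refl (<-≤-trans 1<ℓ ℓ≤1)) }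
  where
  occurs₁ : ∀ ℓ → 1 ≤ ℓ → ℓ ≤ 2 → 0 < count (double 1 point) ℓ
  occurs₁ 1 _ _ = subst (0 <_) (sym (count-double-at 1 point)) (s≤s z≤n)
  occurs₁ 2 _ _ = subst (0 <_) (sym (count-double-next 1 point)) (s≤s z≤n)
  occurs₁ (suc (suc (suc _))) _ (s≤s (s≤s ()))

profile-step : ∀ {G t m s} → Profile G t m → m ≤ s → 1 ≤ s → s ≤ suc t → Profile (double s G) (suc t) s
profile-step {G} {t} {m} {s} P m≤s 1≤s s≤1+t = record
  { occurs = occurs′ ; balanced = trans (count-double-at s G) (sym (count-double-next s G)) ; increasing = increasing′ }
  where
  occurs′ : ∀ ℓ → 1 ≤ ℓ → ℓ ≤ suc (suc t) → 0 < count (double s G) ℓ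
  occurs′ ℓ 1≤ℓ ℓ≤ with <-cmp ℓ s
  ... | tri< ℓ<s _ _ = subst (0 <_) (sym (count-double-below G ℓ<s))
                         (≤-trans (occurs P ℓ 1≤ℓ (≤-trans (<⇒≤ ℓ<s) s≤1+t)) (m≤m+n _ _))
  ... | tri≈ _ refl _ = subst (0 <_) (sym (count-double-at s G)) (occurs P s 1≤s s≤1+t)
  occurs′ (suc k) 1≤ℓ ℓ≤ | tri> _ _ s<1+k with <-cmp k s
  ...   | tri< k<s _ _ = ⊥-elim (<-irrefl refl (<-≤-trans k<s (≤-pred s<1+k)))
  ...   | tri≈ _ refl _ = subst (0 <_) (sym (count-double-next k G)) (occurs P k 1≤s s≤1+t)
  ...   | tri> _ _ s<k = subst (0 <_) (sym (count-double-above G s<k))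
                           (≤-trans (occurs P k (≤-trans 1≤s (<⇒≤ s<k)) (≤-pred ℓ≤)) (m≤m+n _ _))
  increasing′ : ∀ ℓ → s < ℓ → ℓ ≤ suc t → count (double s G) ℓ < count (double s G) (suc ℓ)
  increasing′ (suc k) s<1+k 1+k≤ with <-cmp k s
  ... | tri< k<s _ _ = ⊥-elim (<-irrefl refl (<-≤-trans k<s (≤-pred s<1+k)))
  ... | tri> _ _ s<k =
    subst< (sym (count-double-above G s<k)) (sym (count-double-above G (<-trans s<k (n<1+n k))))
      (+-mono-< grows grows)
    where
    grows : count G k < count G (suc k)
    grows = increasing P k (≤-<-trans m≤s s<k) (≤-pred 1+k≤)
  ... | tri≈ _ refl _ =
    subst< (sym (count-double-next k G)) (sym (count-double-above G (n<1+n k))) (byPrevious (<-cmp m k))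
    where
    byPrevious : Tri (m < k) (m ≡ k) (k < m) → count G k < count G (suc k) + count G (suc k)
    byPrevious (tri< m<k _ _) = <-≤-trans (increasing P k m<k (≤-pred 1+k≤)) (m≤m+n _ _)
    byPrevious (tri≈ _ refl _) = subst (_< count G (suc k) + count G (suc k)) (sym (balanced P))
                                   (<-double (occurs P (suc k) (s≤s z≤n) 1+k≤))
    byPrevious (tri> _ _ k<m) = ⊥-elim (<-irrefl refl (<-≤-trans k<m m≤s))

profile : ∀ {r} → Reverse r → ∀ s → AdmissibleFrom 1 1 (r ∷ʳ s) → Profile (seqGraph (r ∷ʳ s)) (length (r ∷ʳ s)) s
profile [] zero ((() , _) , _)
profile [] 1 _ = profile-base
profile [] (suc (suc _)) ((_ , s≤s ()) , _)
profile (xs ∶ rxs ∶ʳ m) s adm with admissibleFrom-snoc 1 1 (xs ∷ʳ m) s adm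
... | adm′ , m≤s , s≤ =
  subst₂ (λ G t → Profile G t s) (sym (seqGraph-snoc (xs ∷ʳ m) s)) (sym (length-snoc (xs ∷ʳ m) s))
    (profile-step (profile rxs m adm′) m≤s′ (≤-trans (lastOf-≥ 1 1 (xs ∷ʳ m) adm′) m≤s) s≤)
  where
  m≤s′ : m ≤ s
  m≤s′ = subst (_≤ s) (lastOf-snoc 1 xs m) m≤s

double-injective : ∀ a b → a + a ≡ b + b → a ≡ b
double-injective zero    zero    _ = refl
double-injective (suc a) (suc b) e =
  cong suc (double-injective a b (suc-injective (trans (sym (+-suc a a)) (trans (suc-injective e) (+-suc b b)))))

-- Admissible sequences of equal length are determined by the label counts
-- of their graphs: the profile fixes the last entry, and the counts of the
-- graph before the last doubling can be recovered by halving.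
count-injective : ∀ {r r'} → Reverse r → Reverse r' → AdmissibleFrom 1 1 r → AdmissibleFrom 1 1 r' →
  length r ≡ length r' → (∀ ℓ → count (seqGraph r) ℓ ≡ count (seqGraph r') ℓ) → r ≡ r'
count-injective [] [] _ _ _ _ = refl
count-injective [] (ys ∶ _ ∶ʳ y) _ _ len _ with trans len (length-snoc ys y)
... | ()
count-injective (xs ∶ _ ∶ʳ x) [] _ _ len _ with trans (sym len) (length-snoc xs x)
... | ()
count-injective (xs ∶ rxs ∶ʳ s) (ys ∶ rys ∶ʳ s′) adm adm′ len counts
  with admissibleFrom-snoc 1 1 xs s adm | admissibleFrom-snoc 1 1 ys s′ adm′
... | admxs , _ , s≤ | admys , _ , s′≤ with <-cmp s s′
...   | tri< s<s′ _ _ = ⊥-elim (<-irrefl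
        (trans (counts s′) (trans (balanced (profile rys s′ adm′)) (sym (counts (suc s′)))))
        (increasing (profile rxs s adm) s′ s<s′ (subst (s′ ≤_) (trans (sym (length-snoc ys s′)) (sym len)) s′≤)))
...   | tri> _ _ s′<s = ⊥-elim (<-irrefl
        (trans (sym (counts s)) (trans (balanced (profile rxs s adm)) (counts (suc s))))
        (increasing (profile rys s′ adm′) s s′<s (subst (s ≤_) (trans (sym (length-snoc xs s)) len) s≤)))
...   | tri≈ _ refl _ =
  cong (_∷ʳ s) (count-injective rxs rys admxs admys
    (suc-injective (trans (sym (length-snoc xs s)) (trans len (length-snoc ys s)))) halved)
  where
  doubled : ∀ ℓ → count (double s (seqGraph xs)) ℓ ≡ count (double s (seqGraph ys)) ℓ
  doubled ℓ = trans (cong (λ G → count G ℓ) (sym (seqGraph-snoc xs s)))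
                (trans (counts ℓ) (cong (λ G → count G ℓ) (seqGraph-snoc ys s)))
  halved : ∀ ℓ → count (seqGraph xs) ℓ ≡ count (seqGraph ys) ℓ
  halved ℓ with <-cmp ℓ s
  ... | tri< ℓ<s _ _ = double-injective _ _
          (trans (sym (count-double-below (seqGraph xs) ℓ<s)) (trans (doubled ℓ) (count-double-below (seqGraph ys) ℓ<s)))
  ... | tri≈ _ refl _ = trans (sym (count-double-at ℓ (seqGraph xs))) (trans (doubled ℓ) (count-double-at ℓ (seqGraph ys)))
  ... | tri> _ _ s<ℓ = double-injective _ _
          (trans (sym (count-double-above (seqGraph xs) s<ℓ)) (trans (doubled (suc ℓ)) (count-double-above (seqGraph ys) s<ℓ)))

reindex-below : ∀ {s k} → k < s → reindex s k ≡ k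
reindex-below {s} {k} k<s = if-yes (<ᵇ-reflects-< k s) k<s

reindex-above : ∀ {s k} → s ≤ k → reindex s k ≡ k ∸ 1
reindex-above {s} {k} s≤k = if-no (<ᵇ-reflects-< k s) (≤⇒≯ s≤k)

reindex-relabel : ∀ k x → reindex k (relabel k x) ≡ x
reindex-relabel k x with <-cmp x k
... | tri< x<k _ _ = trans (cong (reindex k) (relabel-below x<k)) (reindex-below x<k)
... | tri≈ _ refl _ = trans (cong (reindex k) (relabel-above ≤-refl)) (reindex-above (n≤1+n k))
... | tri> _ _ k<x = trans (cong (reindex k) (relabel-above (<⇒≤ k<x))) (reindex-above (<⇒≤ (<-trans k<x (n<1+n x))))

relabel-≢ : ∀ k x → relabel k x ≢ k
relabel-≢ k x e with <-cmp x k
... | tri< x<k _ _ = <-irrefl (trans (sym (relabel-below x<k)) e) x<k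
... | tri≈ _ refl _ = <-irrefl (sym (trans (sym (relabel-above ≤-refl)) e)) (n<1+n x)
... | tri> _ _ k<x = <-irrefl (sym (trans (sym (relabel-above (<⇒≤ k<x))) e)) (<-trans k<x (n<1+n x))

reindex-mono : ∀ k {x j} → x ≢ k → j ≢ k → x < j → reindex k x < reindex k j
reindex-mono k {x} {j} x≢k j≢k x<j with <-cmp x k | <-cmp j k
... | tri≈ _ x≡k _ | _ = ⊥-elim (x≢k x≡k)
... | _ | tri≈ _ j≡k _ = ⊥-elim (j≢k j≡k)
... | tri< x<k _ _ | tri< j<k _ _ = subst₂ _<_ (sym (reindex-below x<k)) (sym (reindex-below j<k)) x<j
... | tri< x<k _ _ | tri> _ _ k<j = subst₂ _<_ (sym (reindex-below x<k)) (sym (reindex-above (<⇒≤ k<j))) (<-≤-trans x<k (∸-monoˡ-≤ 1 k<j))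
... | tri> _ _ k<x | tri< j<k _ _ = ⊥-elim (<-irrefl refl (<-trans k<x (<-trans x<j j<k)))
... | tri> _ _ k<x | tri> _ _ k<j =
  subst₂ _<_ (sym (reindex-above (<⇒≤ k<x))) (sym (reindex-above (<⇒≤ k<j))) (∸-monoˡ-< x<j (≤-<-trans z≤n k<x))

reindex-reflects-< : ∀ k {x j} → x ≢ k → j ≢ k → reindex k x < reindex k j → x < j
reindex-reflects-< k {x} {j} x≢k j≢k r< with <-cmp x j
... | tri< x<j _ _ = x<j
... | tri≈ _ refl _ = ⊥-elim (<-irrefl refl r<)
... | tri> _ _ j<x = ⊥-elim (<-irrefl refl (<-trans r< (reindex-mono k j≢k x≢k j<x)))

reindex-injective : ∀ k {x j} → x ≢ k → j ≢ k → reindex k x ≡ reindex k j → x ≡ j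
reindex-injective k {x} {j} x≢k j≢k e with <-cmp x j
... | tri< x<j _ _ = ⊥-elim (<-irrefl e (reindex-mono k x≢k j≢k x<j))
... | tri≈ _ x≡j _ = x≡j
... | tri> _ _ j<x = ⊥-elim (<-irrefl (sym e) (reindex-mono k j≢k x≢k j<x))

below : ℕ → List ℕ → ℕ
below j js = length (filter (_<? j) js)

below-reindex : ∀ k j js → j ≢ k → All (_≢ k) js → below (reindex k j) (map (reindex k) js) ≡ below j js
below-reindex k j []       _   _              = refl
below-reindex k j (x ∷ js) j≢k (x≢k ∷ js≢k) = byCase (x <? j)
  where
  rest : below (reindex k j) (map (reindex k) js) ≡ below j js
  rest = below-reindex k j js j≢k js≢k
  byCase : Dec (x < j) → below (reindex k j) (map (reindex k) (x ∷ js)) ≡ below j (x ∷ js)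
  byCase (yes x<j) = trans (cong length (filter-accept (_<? reindex k j) (reindex-mono k x≢k j≢k x<j)))
                       (trans (cong suc rest) (sym (cong length (filter-accept (_<? j) x<j))))
  byCase (no x≮j) = trans (cong length (filter-reject (_<? reindex k j) (λ r< → x≮j (reindex-reflects-< k x≢k j≢k r<))))
                      (trans rest (sym (cong length (filter-reject (_<? j) x≮j))))

canon-entry : ∀ k j js → j ≢ k → All (_≢ k) js →
  j ∸ below j (js ∷ʳ k) ≡ reindex k j ∸ below (reindex k j) (map (reindex k) js)
canon-entry k j js j≢k js≢k
  rewrite cong length (filter-++ (_<? j) js [ k ]) | length-++ (filter (_<? j) js) {filter (_<? j) [ k ]}
        | below-reindex k j js j≢k js≢k with <-cmp j k
... | tri≈ _ j≡k _ = ⊥-elim (j≢k j≡k)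
... | tri< j<k _ _ rewrite reindex-below j<k | filter-reject (_<? j) {xs = []} (λ k<j → <-irrefl refl (<-trans k<j j<k)) =
  cong (j ∸_) (+-identityʳ (below j js))
... | tri> _ _ k<j rewrite reindex-above (<⇒≤ k<j) | filter-accept (_<? j) {xs = []} k<j =
  trans (cong (j ∸_) (+-comm (below j js) 1)) (sym (∸-+-assoc j 1 (below j js)))

canon-snoc : ∀ js k → All (_≢ k) js → canon (js ∷ʳ k) ≡ canon (map (reindex k) js) ∷ʳ k
canon-snoc []       k _              = refl
canon-snoc (j ∷ js) k (j≢k ∷ js≢k) = cong₂ _∷_ (canon-entry k j js j≢k js≢k) (canon-snoc js k js≢k)

canon-length : ∀ ks → length (canon ks) ≡ length ks
canon-length []       = refl
canon-length (k ∷ ks) = cong suc (canon-length ks)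

T-snoc : ∀ n → T (suc n) ≡ T n ∷ʳ suc n
T-snoc n = trans (cong (map suc) (sym (upTo-∷ʳ n))) (map-++ suc (upTo n) [ n ])

T-length : ∀ t → length (T t) ≡ t
T-length t = trans (length-map suc (upTo t)) (length-upTo t)

T-unique : ∀ t → Unique (T t)
T-unique t = Unique.map⁺ suc-injective (Unique.upTo⁺ t)

T-bounds : ∀ t → All (λ k → 1 ≤ k × k ≤ t) (T t)
T-bounds zero    = []
T-bounds (suc t) = subst (All (λ k → 1 ≤ k × k ≤ suc t)) (sym (T-snoc t))
  (All.++⁺ (All.map (λ (1≤k , k≤t) → 1≤k , m≤n⇒m≤1+n k≤t) (T-bounds t)) ((s≤s z≤n , ≤-refl) ∷ []))

relabel-T-↭ : ∀ n k → 1 ≤ k → k ≤ suc n → map (relabel k) (T n) ∷ʳ k ↭ T (suc n)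
relabel-T-↭ zero    1             _   _           = ↭-refl
relabel-T-↭ zero    (suc (suc _)) _   (s≤s ())
relabel-T-↭ (suc n) k             1≤k k≤ with m≤n⇒m<n∨m≡n k≤
... | inj₂ refl = ↭-reflexive (trans (cong (_∷ʳ k) unchanged) (sym (T-snoc (suc n))))
  where
  unchanged : map (relabel k) (T (suc n)) ≡ T (suc n)
  unchanged = map-id-local (All.map (λ (_ , j≤) → relabel-below (s≤s j≤)) (T-bounds (suc n)))
... | inj₁ k<N = begin
  map (relabel k) (T (suc n)) ∷ʳ k   ≡⟨ cong (λ xs → map (relabel k) xs ∷ʳ k) (T-snoc n) ⟩
  map (relabel k) (T n ∷ʳ suc n) ∷ʳ k ≡⟨ cong (_∷ʳ k) (map-++ (relabel k) (T n) [ suc n ]) ⟩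
  (A ∷ʳ relabel k (suc n)) ∷ʳ k      ≡⟨ cong (λ x → (A ∷ʳ x) ∷ʳ k) (relabel-above (≤-pred k<N)) ⟩
  (A ∷ʳ N) ∷ʳ k                      ≡⟨ ++-assoc A [ N ] [ k ] ⟩
  A ++ N ∷ k ∷ []                    ↭⟨ ++⁺ˡ A (↭-swap N k ↭-refl) ⟩
  A ++ k ∷ N ∷ []                    ≡⟨ sym (++-assoc A [ k ] [ N ]) ⟩
  (A ∷ʳ k) ∷ʳ N                      ↭⟨ ++⁺ʳ [ N ] (relabel-T-↭ n k 1≤k (≤-pred k<N)) ⟩
  T (suc n) ∷ʳ N                     ≡⟨ sym (T-snoc (suc n)) ⟩
  T (suc (suc n))                    ∎
  where
  open PermutationReasoning
  A : List ℕ
  A = map (relabel k) (T n)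
  N : ℕ
  N = suc (suc n)

-- Every admissible sequence is a canonical sequence: reading r from the
-- right, each entry k becomes the new maximal symbol, inserted at index k.

orderOfReversed : List ℕ → List ℕ
orderOfReversed []      = []
orderOfReversed (k ∷ R) = map (relabel k) (orderOfReversed R) ∷ʳ k

orderOf : List ℕ → List ℕ
orderOf r = orderOfReversed (reverse r)

orderOf-snoc : ∀ xs k → orderOf (xs ∷ʳ k) ≡ map (relabel k) (orderOf xs) ∷ʳ k
orderOf-snoc xs k = cong orderOfReversed (reverse-++ xs [ k ])

canon-orderOf : ∀ {r} → Reverse r → canon (orderOf r) ≡ r
canon-orderOf [] = refl
canon-orderOf (xs ∶ rxs ∶ʳ k) = begin
  canon (orderOf (xs ∷ʳ k))                                     ≡⟨ cong canon (orderOf-snoc xs k) ⟩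
  canon (map (relabel k) (orderOf xs) ∷ʳ k)                     ≡⟨ canon-snoc _ k (All.map⁺ (All.universal (relabel-≢ k) _)) ⟩
  canon (map (reindex k) (map (relabel k) (orderOf xs))) ∷ʳ k   ≡⟨ cong (λ ys → canon ys ∷ʳ k) reindex∘relabel ⟩
  canon (orderOf xs) ∷ʳ k                                       ≡⟨ cong (_∷ʳ k) (canon-orderOf rxs) ⟩
  xs ∷ʳ k                                                       ∎
  where
  open ≡-Reasoning
  reindex∘relabel : map (reindex k) (map (relabel k) (orderOf xs)) ≡ orderOf xs
  reindex∘relabel = trans (sym (map-∘ (orderOf xs))) (trans (map-cong (reindex-relabel k) _) (map-id _))

orderOf-↭ : ∀ {r} → Reverse r → Bounded 0 r → orderOf r ↭ T (length r)
orderOf-↭ [] _ = ↭-refl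
orderOf-↭ (xs ∶ rxs ∶ʳ k) bounded with bounded-snoc⁻ 0 xs k bounded
... | bxs , 1≤k , k≤ = begin
  orderOf (xs ∷ʳ k)                          ≡⟨ orderOf-snoc xs k ⟩
  map (relabel k) (orderOf xs) ∷ʳ k          ↭⟨ ++⁺ʳ [ k ] (Perm.map⁺ (relabel k) (orderOf-↭ rxs bxs)) ⟩
  map (relabel k) (T (length xs)) ∷ʳ k       ↭⟨ relabel-T-↭ (length xs) k 1≤k k≤ ⟩
  T (suc (length xs))                        ≡⟨ cong T (sym (length-snoc xs k)) ⟩
  T (length (xs ∷ʳ k))                       ∎
  where open PermutationReasoning

IsOrder : ℕ → List ℕ → Set
IsOrder t ks = length ks ≡ t × Unique ks × All (λ k → 1 ≤ k × k ≤ t) ks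

↭⇒IsOrder : ∀ {t ks} → ks ↭ T t → IsOrder t ks
↭⇒IsOrder {t} ks↭T =
  trans (↭-length ks↭T) (T-length t) ,
  Unique-resp-↭ (↭⇒↭ₛ (↭-sym ks↭T)) (T-unique t) ,
  All-resp-↭ (↭-sym ks↭T) (T-bounds t)

unique-snoc⁻ : ∀ (js : List ℕ) k → Unique (js ∷ʳ k) → Unique js × All (_≢ k) js
unique-snoc⁻ []       k _           = [] , []
unique-snoc⁻ (j ∷ js) k (j∉ ∷ uniq) with unique-snoc⁻ js k uniq | All.++⁻ {P = j ≢_} js j∉
... | ujs , js≢k | j∉js , (j≢k ∷ []) = (j∉js ∷ ujs) , (j≢k ∷ js≢k)

unique-reindex : ∀ k {js} → All (_≢ k) js → Unique js → Unique (map (reindex k) js)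
unique-reindex k []             []           = []
unique-reindex k (j≢k ∷ js≢k) (j∉ ∷ uniq) =
  All.map⁺ (All.zipWith (λ (j≢y , y≢k) e → j≢y (reindex-injective k j≢k y≢k e)) (j∉ , js≢k))
  ∷ unique-reindex k js≢k uniq

bounds-reindex : ∀ t k {js} → 1 ≤ k → k ≤ suc t → All (_≢ k) js → All (λ x → 1 ≤ x × x ≤ suc t) js →
  All (λ x → 1 ≤ x × x ≤ t) (map (reindex k) js)
bounds-reindex t k 1≤k k≤ js≢k bounds = All.map⁺ (All.zipWith shift (js≢k , bounds))
  where
  shift : ∀ {x} → x ≢ k × (1 ≤ x × x ≤ suc t) → 1 ≤ reindex k x × reindex k x ≤ t
  shift {x} (x≢k , 1≤x , x≤) with <-cmp x k
  ... | tri< x<k _ _ rewrite reindex-below x<k = 1≤x , ≤-pred (≤-trans x<k k≤)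
  ... | tri≈ _ x≡k _ = ⊥-elim (x≢k x≡k)
  ... | tri> _ _ k<x rewrite reindex-above (<⇒≤ k<x) = ≤-trans 1≤k (∸-monoˡ-≤ 1 k<x) , ∸-monoˡ-≤ 1 x≤

IsOrder-restrict : ∀ t js k → IsOrder (suc t) (js ∷ʳ k) →
  IsOrder t (map (reindex k) js) × (1 ≤ k × k ≤ suc t) × All (_≢ k) js
IsOrder-restrict t js k (len , uniq , bounds) with unique-snoc⁻ js k uniq | All.++⁻ js bounds
... | ujs , js≢k | bjs , ((1≤k , k≤) ∷ []) =
  (trans (length-map (reindex k) js) (suc-injective (trans (sym (length-snoc js k)) len)) ,
   unique-reindex k js≢k ujs , bounds-reindex t k 1≤k k≤ js≢k bjs) ,
  (1≤k , k≤) , js≢k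

canon-bounded : ∀ t ks → IsOrder t ks → Bounded 0 (canon ks)
canon-bounded zero    []      _        = tt
canon-bounded (suc t) ks      ord with reverseView ks
... | js ∶ _ ∶ʳ k with IsOrder-restrict t js k ord
...   | ord′ , (1≤k , k≤) , js≢k =
  subst (Bounded 0) (sym (canon-snoc js k js≢k))
    (bounded-snoc⁺ 0 (canon js′) k (canon-bounded t js′ ord′) 1≤k
      (subst (λ m → k ≤ suc m) (sym (trans (canon-length js′) (proj₁ ord′))) k≤))
  where js′ = map (reindex k) js

lastOr0-snoc : ∀ js k → lastOr0 (js ∷ʳ k) ≡ k
lastOr0-snoc []           k = refl
lastOr0-snoc (j ∷ [])     k = refl
lastOr0-snoc (j ∷ j′ ∷ js) k = lastOr0-snoc (j′ ∷ js) k

dropLast-snoc : ∀ js k → dropLast (js ∷ʳ k) ≡ js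
dropLast-snoc []           k = refl
dropLast-snoc (j ∷ [])     k = refl
dropLast-snoc (j ∷ j′ ∷ js) k = cong (j ∷_) (dropLast-snoc (j′ ∷ js) k)

base-≅ : base ≅ double 1 point
base-≅ = mk≅ flip flip flip² flip² labels adj→ adj←
  where
  flip : Fin 2 → Fin 2
  flip fzero        = fsuc fzero
  flip (fsuc fzero) = fzero
  flip² : ∀ x → flip (flip x) ≡ x
  flip² fzero        = refl
  flip² (fsuc fzero) = refl
  labels : ∀ v → lab (double 1 point) (flip v) ≡ lab base v
  labels fzero        = refl
  labels (fsuc fzero) = refl
  adj→ : ∀ {u v ℓ} → Adj base u v ℓ → Adj (double 1 point) (flip u) (flip v) ℓ
  adj→ (inj₁ (here refl)) = inj₂ (here refl)
  adj→ (inj₂ (here refl)) = inj₁ (here refl)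
  adj← : ∀ {u v ℓ} → Adj (double 1 point) u v ℓ → Adj base (flip u) (flip v) ℓ
  adj← (inj₁ (here refl)) = inj₂ (here refl)
  adj← (inj₂ (here refl)) = inj₁ (here refl)

graph-≅ : ∀ t ks → IsOrder (suc t) ks → graphL (suc t) ks ≅ seqGraph (canon ks)
graph-≅ zero    (1 ∷ [])             _                    = base-≅
graph-≅ zero    (zero ∷ [])          (_ , _ , ((() , _) ∷ []))
graph-≅ zero    (suc (suc _) ∷ [])   (_ , _ , ((_ , s≤s ()) ∷ []))
graph-≅ (suc t) ks                   ord with reverseView ks
... | js ∶ _ ∶ʳ k with IsOrder-restrict (suc t) js k ord
...   | ord′ , _ , js≢k =
  ≅-trans (≡⇒≅ restrict-snoc)
  (≅-trans (double-≅ k (graph-≅ t js′ ord′))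
           (≡⇒≅ (trans (sym (seqGraph-snoc (canon js′) k)) (cong seqGraph (sym (canon-snoc js k js≢k))))))
  where
  js′ : List ℕ
  js′ = map (reindex k) js
  restrict-snoc : graphL (suc (suc t)) (js ∷ʳ k) ≡ double k (graphL (suc t) js′)
  restrict-snoc = cong₂ (λ a b → double a (graphL (suc t) (map (reindex a) b))) (lastOr0-snoc js k) (dropLast-snoc js k)

-- Ballot numbers: ballot n d counts the admissible tails of length n whose
-- first entry may be chosen among d+1 values (ballot t 0 = 𝒞_t).

mutual
  ballot : ℕ → ℕ → ℕ
  ballot zero    d = 1
  ballot (suc n) d = ballotUpTo n d

  -- ballotUpTo n e = Σ_{e' ≤ e} ballot n (e' + 1): the first entry leaves slack e'
  ballotUpTo : ℕ → ℕ → ℕ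
  ballotUpTo n zero    = ballot n 1
  ballotUpTo n (suc e) = ballotUpTo n e + ballot n (suc (suc e))

private
  index₀ : ∀ n → suc n + suc n + 0 ≡ suc (suc (n + n))
  index₀ = solve-∀
  index₁ : ∀ n d → suc n + suc d ≡ suc (suc (n + d))
  index₁ = solve-∀
  index₂ : ∀ n d → suc n + suc n + suc d ≡ suc (suc (suc (n + n + d)))
  index₂ = solve-∀
  index₃ : ∀ n → n + 1 ≡ suc n
  index₃ = solve-∀
  index₄ : ∀ n d → suc n + suc n + d ≡ suc (suc (n + n + d))
  index₄ = solve-∀
  index₅ : ∀ n d → n + suc (suc d) ≡ suc (suc (n + d))
  index₅ = solve-∀

-- The closed form ballot n d · n! · (n+d+1)! = (d+1) · (2n+d)!, written with
-- names m = n + d and k = 2n + d so that each case can choose forms of m and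
-- k in which the factorials unfold.
BallotFormula : ℕ → ℕ → ℕ → ℕ → Set
BallotFormula n d m k = ballot n d * (n ! * (suc m) !) ≡ suc d * k !

ballot-formula-zero : ∀ n {m k} → BallotFormula n 1 (suc n) (suc (n + n)) →
  m ≡ suc n + 0 → k ≡ suc n + suc n + 0 → BallotFormula (suc n) 0 m k
ballot-formula-zero n IH m≡ k≡ rewrite trans m≡ (+-identityʳ (suc n)) | trans k≡ (index₀ n) = begin
  A * ((suc n * f) * R)       ≡⟨ regroup A f R n ⟩
  suc n * (A * (f * R))       ≡⟨ cong (suc n *_) IH ⟩
  suc n * (2 * Q)             ≡⟨ finish Q n ⟩
  1 * (suc (suc (n + n)) * Q) ∎
  where
  open ≡-Reasoning
  A f R Q : ℕ
  A = ballot n 1 ; f = n ! ; R = (suc (suc n)) ! ; Q = (suc (n + n)) !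
  regroup : ∀ A f R n → A * ((suc n * f) * R) ≡ suc n * (A * (f * R))
  regroup = solve-∀
  finish : ∀ Q n → suc n * (2 * Q) ≡ 1 * (suc (suc (n + n)) * Q)
  finish = solve-∀

-- The recurrence ballot (n+1) (d+1) = ballot (n+1) d + ballot n (d+2).
ballot-formula-suc : ∀ n d {m k} →
  BallotFormula (suc n) d (suc (n + d)) (suc (suc (n + n + d))) →
  BallotFormula n (suc (suc d)) (suc (suc (n + d))) (suc (suc (n + n + d))) →
  m ≡ suc n + suc d → k ≡ suc n + suc n + suc d → BallotFormula (suc n) (suc d) m k
ballot-formula-suc n d IH₁ IH₂ m≡ k≡ rewrite trans m≡ (index₁ n d) | trans k≡ (index₂ n d) = begin
  (B + C) * ((suc n * f) * ((3 + (n + d)) * Z))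
    ≡⟨ split B C f Z n d ⟩
  (3 + (n + d)) * (B * ((suc n * f) * Z)) + suc n * (C * (f * ((3 + (n + d)) * Z)))
    ≡⟨ cong₂ _+_ (cong ((3 + (n + d)) *_) IH₁) (cong (suc n *_) IH₂) ⟩
  (3 + (n + d)) * ((1 + d) * Y) + (1 + n) * ((3 + d) * Y)
    ≡⟨ combine Y n d ⟩
  (2 + d) * ((3 + (n + n + d)) * Y) ∎
  where
  open ≡-Reasoning
  B C f Z Y : ℕ
  B = ballot (suc n) d ; C = ballot n (suc (suc d)) ; f = n ! ; Z = (suc (suc (n + d))) ! ; Y = (suc (suc (n + n + d))) !
  split : ∀ B C f Z n d → (B + C) * ((suc n * f) * ((3 + (n + d)) * Z)) ≡
          (3 + (n + d)) * (B * ((suc n * f) * Z)) + suc n * (C * (f * ((3 + (n + d)) * Z)))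
  split = solve-∀
  combine : ∀ Y n d → (3 + (n + d)) * ((1 + d) * Y) + (1 + n) * ((3 + d) * Y) ≡ (2 + d) * ((3 + (n + n + d)) * Y)
  combine = solve-∀

ballot-formula : ∀ n d {m k} → m ≡ n + d → k ≡ n + n + d → BallotFormula n d m k
ballot-formula zero    d       refl refl = noEntries d (d !)
  where
  noEntries : ∀ d f → 1 * (1 * (suc d * f)) ≡ suc d * f
  noEntries = solve-∀
ballot-formula (suc n) zero    m≡ k≡ =
  ballot-formula-zero n (ballot-formula n 1 (sym (index₃ n)) (sym (index₃ (n + n)))) m≡ k≡
ballot-formula (suc n) (suc d) m≡ k≡ =
  ballot-formula-suc n d (ballot-formula (suc n) d refl (sym (index₄ n d)))
    (ballot-formula n (suc (suc d)) (sym (index₅ n d)) (sym (index₅ (n + n) d))) m≡ k≡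

-- Listing the admissible tails: tails hi d n lists, without repetition,
-- the sequences r of length n with AdmissibleFrom hi (hi ∸ d) r.

mutual
  tails : ℕ → ℕ → ℕ → List (List ℕ)
  tails hi d zero    = [ [] ]
  tails hi d (suc n) = tailsUpTo hi n d

  tailsUpTo : ℕ → ℕ → ℕ → List (List ℕ)
  tailsUpTo hi n zero    = map (hi ∷_) (tails (suc hi) 1 n)
  tailsUpTo hi n (suc e) = tailsUpTo hi n e ++ map ((hi ∸ suc e) ∷_) (tails (suc hi) (suc (suc e)) n)

mutual
  length-tails : ∀ hi d n → length (tails hi d n) ≡ ballot n d
  length-tails hi d zero    = refl
  length-tails hi d (suc n) = length-tailsUpTo hi n d

  length-tailsUpTo : ∀ hi n e → length (tailsUpTo hi n e) ≡ ballotUpTo n e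
  length-tailsUpTo hi n zero    = trans (length-map (hi ∷_) (tails (suc hi) 1 n)) (length-tails (suc hi) 1 n)
  length-tailsUpTo hi n (suc e) =
    trans (length-++ (tailsUpTo hi n e))
      (cong₂ _+_ (length-tailsUpTo hi n e)
                 (trans (length-map _ (tails (suc hi) (suc (suc e)) n)) (length-tails (suc hi) (suc (suc e)) n)))

tailsUpTo-∈⁻ : ∀ hi n e r → r ∈ tailsUpTo hi n e →
  Σ ℕ λ e′ → e′ ≤ e × Σ (List ℕ) λ r′ → r′ ∈ tails (suc hi) (suc e′) n × r ≡ (hi ∸ e′) ∷ r′
tailsUpTo-∈⁻ hi n zero r r∈ with ∈-map⁻ (hi ∷_) r∈
... | r′ , r′∈ , refl = 0 , z≤n , r′ , r′∈ , refl
tailsUpTo-∈⁻ hi n (suc e) r r∈ with ∈-++⁻ (tailsUpTo hi n e) r∈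
... | inj₁ r∈e with tailsUpTo-∈⁻ hi n e r r∈e
...   | e′ , e′≤e , r′ , r′∈ , refl = e′ , m≤n⇒m≤1+n e′≤e , r′ , r′∈ , refl
tailsUpTo-∈⁻ hi n (suc e) r r∈ | inj₂ r∈last with ∈-map⁻ ((hi ∸ suc e) ∷_) r∈last
... | r′ , r′∈ , refl = suc e , ≤-refl , r′ , r′∈ , refl

tailsUpTo-∈⁺ : ∀ hi n e e′ r′ → e′ ≤ e → r′ ∈ tails (suc hi) (suc e′) n → ((hi ∸ e′) ∷ r′) ∈ tailsUpTo hi n e
tailsUpTo-∈⁺ hi n zero    zero r′ _ r′∈ = ∈-map⁺ (hi ∷_) r′∈
tailsUpTo-∈⁺ hi n (suc e) e′   r′ e′≤ r′∈ with e′ ≟ suc e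
... | yes refl  = ∈-++⁺ʳ (tailsUpTo hi n e) (∈-map⁺ ((hi ∸ suc e) ∷_) r′∈)
... | no  e′≢ = ∈-++⁺ˡ (tailsUpTo-∈⁺ hi n e e′ r′ (≤-pred (≤∧≢⇒< e′≤ e′≢)) r′∈)

tails-sound : ∀ hi d n r → d < hi → r ∈ tails hi d n → length r ≡ n × AdmissibleFrom hi (hi ∸ d) r
tails-sound hi d zero    .[] _   (here refl) = refl , tt
tails-sound hi d (suc n) r   d<hi r∈ with tailsUpTo-∈⁻ hi n d r r∈
... | e′ , e′≤d , r′ , r′∈ , refl with tails-sound (suc hi) (suc e′) n r′ (s≤s (≤-<-trans e′≤d d<hi)) r′∈
...   | len , adm = cong suc len , (∸-monoʳ-≤ hi e′≤d , m∸n≤m hi e′) , adm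

tails-complete : ∀ hi d n r → d < hi → length r ≡ n → AdmissibleFrom hi (hi ∸ d) r → r ∈ tails hi d n
tails-complete hi d zero    []      _    _   _ = here refl
tails-complete hi d (suc n) (x ∷ r′) d<hi len ((lo≤x , x≤hi) , adm) =
  subst (λ y → (y ∷ r′) ∈ tailsUpTo hi n d) x≡
    (tailsUpTo-∈⁺ hi n d e r′ e≤d
      (tails-complete (suc hi) (suc e) n r′ (s≤s (≤-<-trans e≤d d<hi)) (suc-injective len)
        (subst (λ y → AdmissibleFrom (suc hi) y r′) (sym x≡) adm)))
  where
  e : ℕ
  e = hi ∸ x
  x≡ : hi ∸ e ≡ x
  x≡ = m∸[m∸n]≡n x≤hi
  e≤d : e ≤ d
  e≤d = subst (e ≤_) (m∸[m∸n]≡n (<⇒≤ d<hi)) (∸-monoʳ-≤ hi lo≤x)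

mutual
  tails-unique : ∀ hi d n → d < hi → Unique (tails hi d n)
  tails-unique hi d zero    _    = [] ∷ []
  tails-unique hi d (suc n) d<hi = tailsUpTo-unique hi n d d<hi

  tailsUpTo-unique : ∀ hi n e → e < hi → Unique (tailsUpTo hi n e)
  tailsUpTo-unique hi n zero    e<hi = Unique.map⁺ (λ eq → proj₂ (∷-injective eq)) (tails-unique (suc hi) 1 n (s≤s e<hi))
  tailsUpTo-unique hi n (suc e) e<hi =
    Unique.++⁺ (tailsUpTo-unique hi n e (<-trans (n<1+n e) e<hi))
      (Unique.map⁺ (λ eq → proj₂ (∷-injective eq)) (tails-unique (suc hi) (suc (suc e)) n (s≤s e<hi)))
      disjoint
    where
    -- earlier blocks start with larger first entries than the last block
    disjoint : ∀ {v} → ¬ (v ∈ tailsUpTo hi n e × v ∈ map ((hi ∸ suc e) ∷_) (tails (suc hi) (suc (suc e)) n))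
    disjoint {v} (v∈ , v∈last) with tailsUpTo-∈⁻ hi n e v v∈ | ∈-map⁻ ((hi ∸ suc e) ∷_) v∈last
    ... | e′ , e′≤e , _ , _ , refl | _ , _ , eq =
      <-irrefl (∸-cancelˡ-≡ (≤-trans e′≤e (<⇒≤ (<-trans (n<1+n e) e<hi))) (<⇒≤ e<hi) (proj₁ (∷-injective eq))) (s≤s e′≤e)

mapWith∈-allPairs : ∀ {A B : Set} {R : B → B → Set} (xs : List A) (f : ∀ {x} → x ∈ xs → B) →
  (∀ {x y} (x∈ : x ∈ xs) (y∈ : y ∈ xs) → x ≢ y → R (f x∈) (f y∈)) → Unique xs → AllPairs R (mapWith∈ xs f)
mapWith∈-allPairs []       f related []          = []
mapWith∈-allPairs {R = R} (x ∷ xs) f related (x∉ ∷ uniq) =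
  fromHead xs there x∉ ∷ mapWith∈-allPairs xs (λ y∈ → f (there y∈)) (λ a b → related (there a) (there b)) uniq
  where
  fromHead : ∀ ys (inc : ∀ {y} → y ∈ ys → y ∈ x ∷ xs) → All (x ≢_) ys → All (R (f (here refl))) (mapWith∈ ys (λ y∈ → f (inc y∈)))
  fromHead []       inc []           = []
  fromHead (y ∷ ys) inc (x≢y ∷ x∉ys) = related (here refl) (inc (here refl)) x≢y ∷ fromHead ys (λ y∈ → inc (there y∈)) x∉ys

normalForm-bounded : ∀ t (c : Order t) r → NormalOf (canon (proj₁ c)) r → length r ≡ t × Bounded 0 r
normalForm-bounded t (ks , ks↭T) r (canon⇒r , _) with ↭⇒IsOrder ks↭T
... | ord@(len , _) =
  trans (sym (switches-length canon⇒r)) (trans (canon-length ks) len) ,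
  switches-bounded 0 canon⇒r (canon-bounded t ks ord)

normalForm-admissible : ∀ t (c : Order t) r → NormalOf (canon (proj₁ c)) r → Admissible t r
normalForm-admissible t c r normal@(_ , sorted) with normalForm-bounded t c r normal
... | len , bounded = len , sorted , bounded⇒lookup 0 r bounded

admissible-realized : ∀ t r → Admissible t r → Σ (Order t) λ c → NormalOf (canon (proj₁ c)) r
admissible-realized t r (len , sorted , bounds) =
  (orderOf r , subst (λ n → orderOf r ↭ T n) len (orderOf-↭ (reverseView r) (lookup⇒bounded 0 r bounds))) ,
  subst (λ x → Switches x r) (sym (canon-orderOf (reverseView r))) ε , sorted

graph-≅-normalForm : ∀ t (c : Order (suc t)) r → NormalOf (canon (proj₁ c)) r → 𝒢 (suc t) c ≅ seqGraph r
graph-≅-normalForm t (ks , ks↭T) r (canon⇒r , _) = ≅-trans (graph-≅ t ks (↭⇒IsOrder ks↭T)) (switches-≅ canon⇒r)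

iso-classes : ∀ t (c c′ : Order (suc t)) r r′ → NormalOf (canon (proj₁ c)) r → NormalOf (canon (proj₁ c′)) r′ →
  Iso (𝒢 (suc t) c) (𝒢 (suc t) c′) ⇔ (r ≡ r′)
iso-classes t c c′ r r′ normal normal′ = mk⇔ sameSequence sameGraph
  where
  G≅r : 𝒢 (suc t) c ≅ seqGraph r
  G≅r = graph-≅-normalForm t c r normal
  G′≅r′ : 𝒢 (suc t) c′ ≅ seqGraph r′
  G′≅r′ = graph-≅-normalForm t c′ r′ normal′
  sameSequence : Iso (𝒢 (suc t) c) (𝒢 (suc t) c′) → r ≡ r′
  sameSequence I with normalForm-bounded (suc t) c r normal | normalForm-bounded (suc t) c′ r′ normal′
  ... | len , bounded | len′ , bounded′ =
    count-injective (reverseView r) (reverseView r′)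
      (sorted-bounded⇒admissibleFrom₁ r (proj₂ normal) bounded)
      (sorted-bounded⇒admissibleFrom₁ r′ (proj₂ normal′) bounded′)
      (trans len (sym len′))
      (λ ℓ → sym (count-≅ (≅-trans (≅-sym G≅r) (≅-trans (Iso⇒≅ I) G′≅r′)) ℓ))
  sameGraph : r ≡ r′ → Iso (𝒢 (suc t) c) (𝒢 (suc t) c′)
  sameGraph refl = ≅⇒Iso (≅-trans G≅r (≅-sym G′≅r′))

tails-admissible : ∀ t {r} → r ∈ tails 1 0 t → Admissible t r
tails-admissible t {r} r∈ with tails-sound 1 0 t r (s≤s z≤n) r∈
... | len , adm with admissibleFrom⇒sorted-bounded 0 1 r ≤-refl adm
...   | sorted , bounded = len , sorted , bounded⇒lookup 0 r bounded

catalan-classes : ∀ t →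
  ∃[ L ] ((length L * ((suc t) ! * (suc (suc t)) !) ≡ (2 * suc t) !) ×
          AllPairs (λ c c′ → ¬ Iso (𝒢 (suc t) c) (𝒢 (suc t) c′)) L ×
          (∀ (c : Order (suc t)) → Any (λ d → Iso (𝒢 (suc t) c) (𝒢 (suc t) d)) L))
catalan-classes t = L , size , distinct , covering
  where
  n : ℕ
  n = suc t
  representative : ∀ {r} → r ∈ tails 1 0 n → Σ (Order n) λ c → NormalOf (canon (proj₁ c)) r
  representative {r} r∈ = admissible-realized n r (tails-admissible n r∈)
  L : List (Order n)
  L = mapWith∈ (tails 1 0 n) (λ r∈ → proj₁ (representative r∈))
  size : length L * (n ! * (suc n) !) ≡ (2 * n) !
  size = begin
    length L * (n ! * (suc n) !)                 ≡⟨ cong (_* (n ! * (suc n) !)) (trans (length-mapWith∈ (setoid (List ℕ)) (tails 1 0 n)) (length-tails 1 0 n)) ⟩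
    ballot n 0 * (n ! * (suc n) !)               ≡⟨ ballot-formula n 0 (sym (+-identityʳ n)) (twice n) ⟩
    1 * (2 * n) !                                ≡⟨ *-identityˡ _ ⟩
    (2 * n) !                                    ∎
    where
    open ≡-Reasoning
    twice : ∀ n → 2 * n ≡ n + n + 0
    twice = solve-∀
  distinct : AllPairs (λ c c′ → ¬ Iso (𝒢 n c) (𝒢 n c′)) L
  distinct = mapWith∈-allPairs (tails 1 0 n) _
    (λ {r} {r′} r∈ r′∈ r≢r′ I → r≢r′ (Equivalence.to
      (iso-classes t (proj₁ (representative r∈)) (proj₁ (representative r′∈)) r r′ (proj₂ (representative r∈)) (proj₂ (representative r′∈))) I))
    (tails-unique 1 0 n (s≤s z≤n))
  covering : ∀ c → Any (λ d → Iso (𝒢 n c) (𝒢 n d)) L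
  covering c with normalForm-bounded n c _ (normalOf-exists (canon (proj₁ c)))
  ... | len , bounded = mapWith∈⁺ _ (r , r∈ , Equivalence.from (iso-classes t c (proj₁ (representative r∈)) r r normal (proj₂ (representative r∈))) refl)
    where
    r : List ℕ
    r = normalForm (canon (proj₁ c))
    normal : NormalOf (canon (proj₁ c)) r
    normal = normalOf-exists (canon (proj₁ c))
    r∈ : r ∈ tails 1 0 n
    r∈ = tails-complete 1 0 n r (s≤s z≤n) len (sorted-bounded⇒admissibleFrom₁ r (proj₂ normal) bounded)

lemma6p7 : ∀ (t : ℕ) → 1 ≤ t →
  -- every canonical sequence has a unique nondecreasing normal form under switches
  (∀ (c : Order t) → ∃[ r ] NormalOf (canon (proj₁ c)) r) ×
  (∀ (c : Order t) r r' → NormalOf (canon (proj₁ c)) r → NormalOf (canon (proj₁ c)) r' → r ≡ r') ×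
  -- normal forms are exactly the admissible sequences
  (∀ (c : Order t) r → NormalOf (canon (proj₁ c)) r → Admissible t r) ×
  (∀ r → Admissible t r → Σ (Order t) λ c → NormalOf (canon (proj₁ c)) r) ×
  -- isomorphism classes of 𝒢(c) correspond to normal forms
  (∀ (c c' : Order t) r r' → NormalOf (canon (proj₁ c)) r → NormalOf (canon (proj₁ c')) r' →
    (Iso (𝒢 t c) (𝒢 t c') ⇔ (r ≡ r'))) ×
  -- the number of isomorphism classes is the Catalan number (2t)! / (t! (t+1)!)
  (∃[ L ] ((length L * (t ! * (suc t) !) ≡ (2 * t) !) ×
           AllPairs (λ c c' → ¬ Iso (𝒢 t c) (𝒢 t c')) L ×
           (∀ (c : Order t) → Any (λ d → Iso (𝒢 t c) (𝒢 t d)) L)))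
lemma6p7 zero    ()
lemma6p7 (suc t) _ =
  (λ c → normalForm (canon (proj₁ c)) , normalOf-exists (canon (proj₁ c))) ,
  (λ c r r′ normal normal′ → trans (normalOf-unique _ r normal) (sym (normalOf-unique _ r′ normal′))) ,
  normalForm-admissible (suc t) ,
  admissible-realized (suc t) ,
  iso-classes t ,
  catalan-classes t
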